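{- The class of unit interval graphs and the class of bipartite permutation graphs each admit low rank-width colorings.
   Context: All graphs are finite and simple. A unit interval graph is the intersection graph of a family of intervals on the real line all of the same length. A permutation graph is the intersection graph of line segments whose endpoints lie on two parallel lines; a bipartite permutation graph is a permutation graph that is bipartite. Rank-width: for a graph $G$ and $X\subseteq V(G)$, $\mathrm{cutrk}_G(X)$ is the rank over GF(2) of the adjacency submatrix with rows $X$ and columns $V(G)\setminus X$; a rank-decomposition is a tree with all nodes of degree 1 or 3 whose leaves are in bijection with $V(G)$, an edge $e$ has width $\mathrm{cutrk}_G$ of the vertex set on one side of $e$, and the rank-width is the minimum over rank-decompositions of the maximum edge width ($0$ for graphs with at most one vertex). A class $\mathcal{D}$ of graphs admits low rank-width colorings if there exist functions $N,Q\colon\mathbb{N}\to\mathbb{N}$ such that for all $p\in\mathbb{N}$, every $G\in\mathcal{D}$ can be vertex colored with at most $N(p)$ colors such that the union of any $i\le p$ color classes induces a subgraph of rank-width at most $Q(i)$.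
   Formalization: The interval endpoints and common length of unit interval graphs, and the segment endpoints on the two parallel lines of permutation graphs, are rational instead of real. -}

module Defs where

open import Data.Nat using (ℕ; zero; suc; _≤_; _+_)
open import Data.Fin using (Fin; zero; suc; inject₁; fromℕ)
open import Data.Bool using (Bool; true; false; _xor_; _∧_; if_then_else_)
open import Data.Product using (Σ; ∃; _×_; _,_)
open import Data.Sum using (_⊎_)
open import Relation.Binary.PropositionalEquality using (_≡_; _≢_)
open import Relation.Nullary using (¬_)
open import Function.Definitions using (Injective)
open import Function.Bundles using (_⇔_)
open import Data.Rational using (ℚ; 0ℚ; 1ℚ) renaming (_≤_ to _≤ℚ_; _+_ to _+ℚ_; _*_ to _*ℚ_; _-_ to _-ℚ_)

record Graph (n : ℕ) : Set where
  field
    adj    : Fin n → Fin n → Bool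
    sym    : ∀ i j → adj i j ≡ adj j i
    irrefl : ∀ i → adj i i ≡ false

open Graph public

induced : ∀ {n m} → Graph n → (Fin m → Fin n) → Graph m
induced G f = record
  { adj = λ i j → adj G (f i) (f j)
  ; sym = λ i j → sym G (f i) (f j)
  ; irrefl = λ i → irrefl G (f i) }

-- GF(2) arithmetic: Bool with xor as +, ∧ as *

xorSum : ∀ {k} → (Fin k → Bool) → Bool
xorSum {zero}  f = false
xorSum {suc k} f = f zero xor xorSum (λ i → f (suc i))

-- cutrk_G(X) ≤ r : the GF(2) matrix with rows X and columns V(G) \ X has
-- rank ≤ r, i.e. its row space is contained in the span of r vectors b_1..b_r.
CutRk≤ : ∀ {n} → Graph n → (Fin n → Set) → ℕ → Set
CutRk≤ {n} G X r =
  Σ (Fin r → Fin n → Bool) λ b →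
    ∀ x → X x → Σ (Fin r → Bool) λ c →
      ∀ y → ¬ X y → adj G x y ≡ xorSum (λ j → c j ∧ b j y)

countTrue : ∀ {k} → (Fin k → Bool) → ℕ
countTrue {zero}  f = 0
countTrue {suc k} f = (if f zero then 1 else 0) + countTrue (λ i → f (suc i))

degree : ∀ {t} → Graph t → Fin t → ℕ
degree T u = countTrue (adj T u)

data Walk {t} (T : Graph t) : Fin t → Fin t → Set where
  here : ∀ {x} → Walk T x x
  step : ∀ {x y z} → adj T x y ≡ true → Walk T y z → Walk T x z

data WalkAvoiding {t} (T : Graph t) (a b : Fin t) : Fin t → Fin t → Set where
  here : ∀ {x} → WalkAvoiding T a b x x
  step : ∀ {x y z} → adj T x y ≡ true →
         ¬ ((x ≡ a × y ≡ b) ⊎ (x ≡ b × y ≡ a)) →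
         WalkAvoiding T a b y z → WalkAvoiding T a b x z

Connected : ∀ {t} → Graph t → Set
Connected {t} T = ∀ (x y : Fin t) → Walk T x y

-- a cycle of length m+3: distinct vertices c_0,...,c_{m+2}, consecutive ones
-- adjacent and c_{m+2} adjacent to c_0
HasCycle : ∀ {t} → Graph t → Set
HasCycle {t} T =
  Σ ℕ λ m → Σ (Fin (suc (suc (suc m))) → Fin t) λ c →
    Injective _≡_ _≡_ c ×
    (∀ (i : Fin (suc (suc m))) → adj T (c (inject₁ i)) (c (suc i)) ≡ true) ×
    adj T (c (fromℕ (suc (suc m)))) (c zero) ≡ true

IsTree : ∀ {t} → Graph t → Set
IsTree T = Connected T × ¬ HasCycle T

record RankDecomposition {n t} (G : Graph n) (T : Graph t) (k : ℕ) : Set where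
  field
    tree     : IsTree T
    degrees  : ∀ u → degree T u ≡ 1 ⊎ degree T u ≡ 3
    leaf     : Fin n → Fin t
    leafInj  : Injective _≡_ _≡_ leaf
    leafDeg  : ∀ x → degree T (leaf x) ≡ 1
    leafSurj : ∀ u → degree T u ≡ 1 → ∃ λ x → leaf x ≡ u
    -- every edge uv of T has width ≤ k; the side of the edge containing u is
    -- the set of leaves reachable from u without traversing uv
    width    : ∀ u v → adj T u v ≡ true →
               CutRk≤ G (λ x → WalkAvoiding T u v u (leaf x)) k

RankWidth≤ : ∀ {n} → Graph n → ℕ → Set
RankWidth≤ {n} G k =
  n ≤ 1 ⊎ Σ ℕ λ t → Σ (Graph t) λ T → RankDecomposition G T k

InducedRankWidth≤ : ∀ {n} → Graph n → (Fin n → Set) → ℕ → Set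
InducedRankWidth≤ {n} G S k =
  Σ ℕ λ m → Σ (Fin m → Fin n) λ f →
    Injective _≡_ _≡_ f ×
    (∀ x → S x ⇔ (∃ λ i → f i ≡ x)) ×
    RankWidth≤ (induced G f) k

GraphClass : Set₁
GraphClass = (n : ℕ) → Graph n → Set

-- intersection graph of closed intervals [a_i, a_i + ℓ], all of length ℓ
UnitInterval : GraphClass
UnitInterval n G =
  Σ ℚ λ ℓ → Σ (Fin n → ℚ) λ a →
    0ℚ ≤ℚ ℓ ×
    (∀ i j → i ≢ j →
      (adj G i j ≡ true ⇔
        (∃ λ q → (a i ≤ℚ q × q ≤ℚ a i +ℚ ℓ) × (a j ≤ℚ q × q ≤ℚ a j +ℚ ℓ))))

-- segment i joins (x_i , 0) and (y_i , 1); its point at height s is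
-- x_i + s (y_i - x_i)
Permutation : GraphClass
Permutation n G =
  Σ (Fin n → ℚ) λ x → Σ (Fin n → ℚ) λ y →
    ∀ i j → i ≢ j →
      (adj G i j ≡ true ⇔
        (∃ λ s → (0ℚ ≤ℚ s × s ≤ℚ 1ℚ) ×
          (x i +ℚ s *ℚ (y i -ℚ x i) ≡ x j +ℚ s *ℚ (y j -ℚ x j))))

Bipartite : GraphClass
Bipartite n G =
  Σ (Fin n → Bool) λ col → ∀ i j → adj G i j ≡ true → col i ≢ col j

BipartitePermutation : GraphClass
BipartitePermutation n G = Permutation n G × Bipartite n G

AdmitsLowRankWidthColorings : GraphClass → Set
AdmitsLowRankWidthColorings D =
  Σ (ℕ → ℕ) λ N → Σ (ℕ → ℕ) λ Q →
    ∀ (p n : ℕ) (G : Graph n) → D n G →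
      Σ (Fin n → Fin (N p)) λ col →
        ∀ (i : ℕ) → i ≤ p → (C : Fin i → Fin (N p)) → Injective _≡_ _≡_ C →
          InducedRankWidth≤ G (λ v → ∃ λ j → col v ≡ C j) (Q i)

{-# OPTIONS --safe #-}
module Submission where

-- In both classes the non-adjacent vertices on compatible sides are ordered left to right (u ≺ v):
-- for unit intervals, the interval of u ends before that of v begins; for bipartite permutation
-- graphs, u and v have different colours and the segment of u lies entirely to the left of that
-- of v.  Put every vertex in the layer given by the length of a longest ≺-chain below it; edges
-- only join equal or consecutive layers.  Colour a vertex by its layer modulo p + 1.  Any i ≤ p
-- colour classes miss a residue, and cutting the layers there splits the chosen vertices into
-- blocks of consecutive layers with no edges between blocks.  Inside a block, sort the vertices
-- lexicographically by the positions along the rightmost ≺-chain below them: then an earlier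
-- vertex u and a later vertex v are adjacent exactly when their sides are compatible and v lies
-- in the layer of u or the one below.  Hence the row of a vertex across any prefix/suffix cut of
-- this order depends only on its (colour, side) type, there are 2 (i + 1) types, and a
-- caterpillar-shaped rank-decomposition has width at most 2 (i + 1).

open import Defs renaming (sym to adj-sym; irrefl to adj-irrefl)
open import Data.Nat using (ℕ; zero; suc; _≤_; _<_; _+_; _*_; _∸_; _⊔_; z≤n; s≤s; NonZero)
import Data.Nat.Properties as ℕ
open import Data.Nat.DivMod
  using (_%_; _/_; m≡m%n+[m/n]*n; [m+n]%n≡m%n; [m+kn]%n≡m%n; %-distribˡ-+; m%n%n≡m%n; m<n⇒m%n≡m;
         m%n<n; n%n≡0; +-distrib-/; m<n⇒m/n≡0)
open import Data.Fin using (Fin; zero; suc; toℕ; inject₁; fromℕ; fromℕ<; splitAt; join; _≟_)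
import Data.Fin.Properties as Fin
open import Data.Fin.Relation.Unary.Top using (view; ‵fromℕ; ‵inject₁; view-fromℕ; view-inject₁)
open import Data.Bool using (Bool; true; false; _∧_; _∨_; _xor_; not; if_then_else_)
import Data.Bool.Properties as Bool
open import Data.Bool.Properties using (xor-identityʳ; ∧-identityʳ; ∧-zeroʳ; ¬-not)
open import Data.List using (List; []; _∷_; [_]; _∷ʳ_; length; map; lookup; filter; allFin)
open import Data.List.Properties using (length-map; length-++)
open import Data.List.Membership.Propositional using (_∈_)
open import Data.List.Membership.Propositional.Properties
  using (∈-map⁺; ∈-map⁻; ∈-filter⁺; ∈-filter⁻; ∈-lookup; ∈-allFin)
open import Data.List.Relation.Unary.Any using (here; there; index)
open import Data.List.Relation.Unary.Any.Properties using (lookup-index)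
import Data.List.Relation.Unary.All as All
open import Data.List.Relation.Unary.All using ([]; _∷_)
open import Data.List.Relation.Unary.Unique.Propositional using (Unique; []; _∷_)
import Data.List.Relation.Unary.Unique.Propositional.Properties as Unique
open import Data.List.Relation.Binary.Permutation.Propositional using (↭-sym; ↭⇒↭ₛ)
open import Data.List.Relation.Binary.Permutation.Propositional.Properties using (∈-resp-↭)
import Data.List.Relation.Binary.Permutation.Setoid.Properties as Permutation
open import Data.List.Relation.Binary.Lex.Strict using (Lex-<; Lex-≤; base; halt; this; next)
  renaming (≤-decTotalOrder to lex-decTotalOrder)
open import Data.Product.Relation.Binary.Lex.NonStrict using (×-decTotalOrder)
open import Data.Rational using (ℚ; 0ℚ; 1ℚ; -_; 1/_)
  renaming (_+_ to _+ℚ_; _*_ to _*ℚ_; _-_ to _-ℚ_; _≤_ to _≤ℚ_; _<_ to _<ℚ_)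
import Data.Rational as ℚ
import Data.Rational.Properties as ℚ
open import Data.Rational.Solver using (module +-*-Solver)
open import Data.Product using (Σ; ∃; ∃₂; _×_; _,_; proj₁; proj₂)
import Data.Product as Prod
open import Data.Sum using (_⊎_; inj₁; inj₂)
import Data.Sum as Sum
import Data.Sum.Properties as Sum
open import Data.Unit using (⊤)
open import Data.Empty using (⊥-elim)
open import Function using (_∘_)
open import Level using (0ℓ)
open import Function.Definitions using (Injective)
open import Function.Bundles using (_⇔_; mk⇔; Equivalence)
import Function.Properties.Equivalence as ⇔
open import Relation.Binary.PropositionalEquality hiding ([_])
open import Relation.Binary.Bundles using (DecTotalOrder)
open import Relation.Binary.Definitions using (tri<; tri≈; tri>)
import Relation.Binary.Definitions as Binary
import Relation.Binary.Construct.On as On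
open import Relation.Nullary using (¬_; Dec; yes; no; does)
open import Relation.Nullary.Decidable using (_×-dec_; _⊎-dec_; ¬?; dec-true; dec-false; does-⇔)
import Relation.Nullary.Decidable as Dec
open import Relation.Unary using (Decidable)

open Equivalence using (to; from)

false≢true : false ≢ true
false≢true ()

does⇔ : ∀ {A : Set} (a? : Dec A) → does a? ≡ true ⇔ A
does⇔ (yes a) = mk⇔ (λ _ → a) (λ _ → refl)
does⇔ (no ¬a) = mk⇔ (λ ()) (λ a → ⊥-elim (¬a a))

∧-does-yes : ∀ {A : Set} b (a? : Dec A) → A → b ∧ does a? ≡ b
∧-does-yes b a? a = trans (cong (b ∧_) (dec-true a? a)) (∧-identityʳ b)

∧-does-no : ∀ {A : Set} b (a? : Dec A) → ¬ A → b ∧ does a? ≡ false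
∧-does-no b a? ¬a = trans (cong (b ∧_) (dec-false a? ¬a)) (∧-zeroʳ b)

adj⇒≢ : ∀ {n} (G : Graph n) {u v} → adj G u v ≡ true → u ≢ v
adj⇒≢ G {u} uv refl = false≢true (trans (sym (adj-irrefl G u)) uv)

countTrue-cong : ∀ {n} {f g : Fin n → Bool} → (∀ i → f i ≡ g i) → countTrue f ≡ countTrue g
countTrue-cong {zero} f≗g = refl
countTrue-cong {suc n} f≗g =
  cong₂ _+_ (cong (λ b → if b then 1 else 0) (f≗g zero)) (countTrue-cong (f≗g ∘ suc))

countTrue-false : ∀ {n} {f : Fin n → Bool} → (∀ i → f i ≡ false) → countTrue f ≡ 0
countTrue-false {zero} f≗false = refl
countTrue-false {suc n} f≗false rewrite f≗false zero = countTrue-false (f≗false ∘ suc)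

countTrue-∨ : ∀ {n} (f g : Fin n → Bool) → (∀ i → f i ∧ g i ≡ false) →
              countTrue (λ i → f i ∨ g i) ≡ countTrue f + countTrue g
countTrue-∨ {zero} f g disjoint = refl
countTrue-∨ {suc n} f g disjoint
  with f zero | g zero | disjoint zero | countTrue-∨ (f ∘ suc) (g ∘ suc) (disjoint ∘ suc)
... | true  | false | _ | ih = cong suc ih
... | false | true  | _ | ih = trans (cong suc ih) (sym (ℕ.+-suc _ _))
... | false | false | _ | ih = ih

countTrue-mono : ∀ {n} {f g : Fin n → Bool} → (∀ i → f i ≡ true → g i ≡ true) → countTrue f ≤ countTrue g
countTrue-mono {zero} f⇒g = z≤n
countTrue-mono {suc n} {f} {g} f⇒g with f zero in f0 | g zero in g0
... | true | true = s≤s (countTrue-mono (f⇒g ∘ suc))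
... | true | false = ⊥-elim (false≢true (trans (sym g0) (f⇒g zero f0)))
... | false | true = ℕ.m≤n⇒m≤1+n (countTrue-mono (f⇒g ∘ suc))
... | false | false = countTrue-mono (f⇒g ∘ suc)

countTrue-mono-< : ∀ {n} {f g : Fin n → Bool} w → (∀ i → f i ≡ true → g i ≡ true) →
                   f w ≡ false → g w ≡ true → countTrue f < countTrue g
countTrue-mono-< {suc n} zero f⇒g fw gw rewrite fw | gw = s≤s (countTrue-mono (f⇒g ∘ suc))
countTrue-mono-< {suc n} {f} {g} (suc w) f⇒g fw gw with f zero in f0 | g zero in g0
... | true | true = s≤s (countTrue-mono-< w (f⇒g ∘ suc) fw gw)
... | true | false = ⊥-elim (false≢true (trans (sym g0) (f⇒g zero f0)))
... | false | true = ℕ.m≤n⇒m≤1+n (countTrue-mono-< w (f⇒g ∘ suc) fw gw)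
... | false | false = countTrue-mono-< w (f⇒g ∘ suc) fw gw

countTrue-≟ : ∀ {n} (a : Fin n) → countTrue (λ i → does (i ≟ a)) ≡ 1
countTrue-≟ {suc n} zero = cong suc (countTrue-false {n} (λ _ → refl))
countTrue-≟ (suc a) = countTrue-≟ a

countTrue-remove : ∀ {n} (f : Fin n → Bool) x → f x ≡ true →
                   countTrue f ≡ suc (countTrue (λ i → f i ∧ not (does (i ≟ x))))
countTrue-remove {n} f x fx = begin
  countTrue f                                     ≡⟨ countTrue-cong split ⟩
  countTrue (λ i → does (i ≟ x) ∨ f′ i)           ≡⟨ countTrue-∨ _ f′ disjoint ⟩
  countTrue (λ i → does (i ≟ x)) + countTrue f′   ≡⟨ cong (_+ countTrue f′) (countTrue-≟ x) ⟩
  suc (countTrue f′)                              ∎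
  where
  open ≡-Reasoning
  f′ : Fin n → Bool
  f′ i = f i ∧ not (does (i ≟ x))
  split : ∀ i → f i ≡ does (i ≟ x) ∨ f′ i
  split i with i ≟ x
  ... | yes refl = fx
  ... | no _ = sym (∧-identityʳ (f i))
  disjoint : ∀ i → does (i ≟ x) ∧ f′ i ≡ false
  disjoint i with i ≟ x
  ... | yes _ = ∧-zeroʳ (f i)
  ... | no _ = refl

countTrue-exactly : ∀ {n} (f : Fin n → Bool) (xs : List (Fin n)) → Unique xs →
                    (∀ i → f i ≡ true ⇔ i ∈ xs) → countTrue f ≡ length xs
countTrue-exactly f [] [] f⇔∈ = countTrue-false λ i → f≢true i (f i) refl
  where
  f≢true : ∀ i b → f i ≡ b → b ≡ false
  f≢true i true fi with () ← to (f⇔∈ i) fi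
  f≢true i false _ = refl
countTrue-exactly f (x ∷ xs) (x∉xs ∷ unique) f⇔∈ =
  trans (countTrue-remove f x (from (f⇔∈ x) (here refl))) (cong suc (countTrue-exactly _ xs unique f′⇔∈))
  where
  f′⇔∈ : ∀ i → f i ∧ not (does (i ≟ x)) ≡ true ⇔ i ∈ xs
  f′⇔∈ i with i ≟ x
  ... | yes refl = mk⇔ (λ fx∧false → ⊥-elim (false≢true (trans (sym (∧-zeroʳ (f x))) fx∧false)))
                       (λ x∈xs → ⊥-elim (All.lookup x∉xs x∈xs refl))
  ... | no i≢x = mk⇔ (λ fi → there-or-absurd (to (f⇔∈ i) (trans (sym (∧-identityʳ (f i))) fi)))
                     (λ i∈xs → trans (∧-identityʳ (f i)) (from (f⇔∈ i) (there i∈xs)))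
    where
    there-or-absurd : i ∈ x ∷ xs → i ∈ xs
    there-or-absurd (here i≡x) = ⊥-elim (i≢x i≡x)
    there-or-absurd (there i∈xs) = i∈xs

module _ {n} {_⊏_ : Fin n → Fin n → Set} (_⊏?_ : ∀ u v → Dec (u ⊏ v)) where

  height : Fin n → ℕ
  height v = countTrue (λ z → does (z ⊏? v))

  ⊏⇒height< : (∀ {x y z} → x ⊏ y → y ⊏ z → x ⊏ z) → (∀ {x} → ¬ x ⊏ x) →
              ∀ {u v} → u ⊏ v → height u < height v
  ⊏⇒height< ⊏-trans ⊏-irrefl {u} {v} u⊏v =
    countTrue-mono-< u (λ z z⊏u → dec-true (z ⊏? v) (⊏-trans (to (does⇔ (z ⊏? u)) z⊏u) u⊏v))
                     (dec-false (u ⊏? u) ⊏-irrefl) (dec-true (u ⊏? v) u⊏v)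

xorSum-false : ∀ {k} → xorSum {k} (λ _ → false) ≡ false
xorSum-false {zero} = refl
xorSum-false {suc k} = xorSum-false {k}

xorSum-select : ∀ {k} (t : Fin k) (h : Fin k → Bool) → xorSum (λ j → does (t ≟ j) ∧ h j) ≡ h t
xorSum-select {suc k} zero h = trans (cong (h zero xor_) (xorSum-false {k})) (xor-identityʳ (h zero))
xorSum-select (suc t) h = xorSum-select t (h ∘ suc)

module _ {n} (G : Graph n) where

  CutRk≤-cong : ∀ {X Y : Fin n → Set} {r} → (∀ x → X x ⇔ Y x) → CutRk≤ G X r → CutRk≤ G Y r
  CutRk≤-cong X⇔Y (b , rows) = b , λ x Yx →
    let (c , row≡) = rows x (from (X⇔Y x) Yx) in c , λ y ¬Yy → row≡ y (¬Yy ∘ to (X⇔Y y))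

  CutRk≤-fromRows : ∀ {X : Fin n → Set} {r} (b : Fin r → Fin n → Bool) →
    (∀ x → X x → (∀ y → ¬ X y → adj G x y ≡ false) ⊎ (∃ λ t → ∀ y → ¬ X y → adj G x y ≡ b t y)) →
    CutRk≤ G X r
  CutRk≤-fromRows {X} {r} b rows = b , λ x Xx → combination (rows x Xx)
    where
    combination : ∀ {x} → (∀ y → ¬ X y → adj G x y ≡ false) ⊎ (∃ λ t → ∀ y → ¬ X y → adj G x y ≡ b t y) →
                  Σ (Fin r → Bool) λ c → ∀ y → ¬ X y → adj G x y ≡ xorSum (λ j → c j ∧ b j y)
    combination (inj₁ zeroRow) = (λ _ → false) , λ y ¬Xy → trans (zeroRow y ¬Xy) (sym (xorSum-false {r}))
    combination (inj₂ (t , row≡b)) = (λ j → does (t ≟ j)) , λ y ¬Xy →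
      trans (row≡b y ¬Xy) (sym (xorSum-select t (λ j → b j y)))

  CutRk≤-singleton : ∀ a r → CutRk≤ G (_≡ a) (suc r)
  CutRk≤-singleton a r = CutRk≤-fromRows (λ _ → adj G a) λ { x refl → inj₂ (zero , λ _ _ → refl) }

  CutRk≤-cosingleton : ∀ a r → CutRk≤ G (_≢ a) (suc r)
  CutRk≤-cosingleton a r = CutRk≤-fromRows (λ _ _ → true) λ x _ → column x (adj G x a) refl
    where
    onlyColumn : ∀ {y} → ¬ y ≢ a → y ≡ a
    onlyColumn {y} ¬y≢a with y ≟ a
    ... | yes y≡a = y≡a
    ... | no y≢a = ⊥-elim (¬y≢a y≢a)
    column : ∀ x b → adj G x a ≡ b →
             (∀ y → ¬ y ≢ a → adj G x y ≡ false) ⊎ (∃ λ (t : Fin (suc r)) → ∀ y → ¬ y ≢ a → adj G x y ≡ true)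
    column x true xa = inj₂ (zero , λ y ¬y≢a → subst (λ z → adj G x z ≡ true) (sym (onlyColumn ¬y≢a)) xa)
    column x false xa = inj₁ λ y ¬y≢a → subst (λ z → adj G x z ≡ false) (sym (onlyColumn ¬y≢a)) xa

-- Trees

Traverses : ∀ {t} → Fin t → Fin t → Fin t → Fin t → Set
Traverses a b x y = (x ≡ a × y ≡ b) ⊎ (x ≡ b × y ≡ a)

module _ {t} {T : Graph t} where

  walkAvoiding⇒walk : ∀ {a b x y} → WalkAvoiding T a b x y → Walk T x y
  walkAvoiding⇒walk here = here
  walkAvoiding⇒walk (step xy _ p) = step xy (walkAvoiding⇒walk p)

  walkAvoiding-++ : ∀ {a b x y z} → WalkAvoiding T a b x y → WalkAvoiding T a b y z → WalkAvoiding T a b x z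
  walkAvoiding-++ here q = q
  walkAvoiding-++ (step xy ¬ab p) q = step xy ¬ab (walkAvoiding-++ p q)

  walkAvoiding-reverse : ∀ {a b x y} → WalkAvoiding T a b x y → WalkAvoiding T a b y x
  walkAvoiding-reverse here = here
  walkAvoiding-reverse (step {x} {y} xy ¬ab p) =
    walkAvoiding-++ (walkAvoiding-reverse p)
                    (step (trans (adj-sym T y x) xy) (¬ab ∘ Sum.swap ∘ Sum.map Prod.swap Prod.swap) here)

  walkAvoiding-preserves : ∀ {a b} (R : Fin t → Set) →
    (∀ x y → adj T x y ≡ true → ¬ Traverses a b x y → R x → R y) →
    ∀ {x y} → WalkAvoiding T a b x y → R x → R y
  walkAvoiding-preserves R step-preserves here Rx = Rx
  walkAvoiding-preserves R step-preserves (step xy ¬ab p) Rx =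
    walkAvoiding-preserves R step-preserves p (step-preserves _ _ xy ¬ab Rx)

  ¬Traverses-loop : ∀ {a x y} → adj T x y ≡ true → ¬ Traverses a a x y
  ¬Traverses-loop xy (inj₁ (refl , refl)) = adj⇒≢ T xy refl
  ¬Traverses-loop xy (inj₂ (refl , refl)) = adj⇒≢ T xy refl

argmin : ∀ {N} (g : Fin (suc N) → ℕ) → Σ (Fin (suc N)) λ i → ∀ j → g i ≤ g j
argmin {zero} g = zero , λ { zero → ℕ.≤-refl }
argmin {suc N} g with argmin (g ∘ suc)
... | i , i-min with g zero ℕ.≤? g (suc i)
...   | yes g0≤ = zero , λ { zero → ℕ.≤-refl ; (suc j) → ℕ.≤-trans g0≤ (i-min j) }
...   | no g0≰ = suc i , λ { zero → ℕ.<⇒≤ (ℕ.≰⇒> g0≰) ; (suc j) → i-min j }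

module _ {t} (T : Graph t) where

  cycle-neighbours : ∀ {m} (c : Fin (suc (suc (suc m))) → Fin t) →
    (∀ i → adj T (c (inject₁ i)) (c (suc i)) ≡ true) → adj T (c (fromℕ (suc (suc m)))) (c zero) ≡ true →
    ∀ i → ∃₂ λ j j′ → j ≢ j′ × adj T (c i) (c j) ≡ true × adj T (c i) (c j′) ≡ true
  cycle-neighbours c path wrap zero = suc zero , fromℕ _ , (λ ()) , path zero , trans (adj-sym T _ _) wrap
  cycle-neighbours c path wrap (suc i) with view i
  ... | ‵fromℕ = zero , inject₁ (fromℕ _) , (λ ()) , wrap , trans (adj-sym T _ _) (path (fromℕ _))
  ... | ‵inject₁ j =
    suc (suc j) , inject₁ (inject₁ j) , apart , path (suc j) , trans (adj-sym T _ _) (path (inject₁ j))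
    where
    apart : suc (suc j) ≢ inject₁ (inject₁ j)
    apart e = ℕ.m≢1+n+m (toℕ j) {1} (sym (trans (cong toℕ e) (trans (Fin.toℕ-inject₁ _) (Fin.toℕ-inject₁ j))))

  -- On a cycle, the vertex of least potential has two distinct neighbours of larger potential.
  ¬HasCycle-byPotential : (ρ : Fin t → ℕ) → (∀ u v → adj T u v ≡ true → ρ u ≢ ρ v) →
    (∀ u v w → adj T u v ≡ true → adj T u w ≡ true → ρ u < ρ v → ρ u < ρ w → v ≡ w) → ¬ HasCycle T
  ¬HasCycle-byPotential ρ adj⇒ρ≢ atMostOneUp (m , c , c-inj , path , wrap) with argmin (ρ ∘ c)
  ... | i , i-min with cycle-neighbours c path wrap i
  ... | j , j′ , j≢j′ , ij , ij′ = j≢j′ (c-inj (atMostOneUp _ _ _ ij ij′ (up ij) (up ij′)))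
    where
    up : ∀ {k} → adj T (c i) (c k) ≡ true → ρ (c i) < ρ (c k)
    up ik = ℕ.≤∧≢⇒< (i-min _) (adj⇒ρ≢ _ _ ik)

-- The spine nodes P 0 … P (k+1) form a path and the pendant node inj₂ s hangs from P (s+1).
-- Vertex 0 of the graph is the leaf P 0, vertex k+1 the leaf P (k+1), and every other vertex s+1
-- the leaf inj₂ s, so every tree edge separates a prefix, a suffix, one vertex or all but one vertex.
module Caterpillar (k : ℕ) where

  m t : ℕ
  m = suc (suc k)
  t = m + k

  Node : Set
  Node = Fin m ⊎ Fin k

  position : Node → ℕ
  position (inj₁ a) = toℕ a
  position (inj₂ s) = suc (toℕ s)

  data Arc : Node → Node → Set where
    spine   : ∀ {a b} → suc (toℕ a) ≡ toℕ b → Arc (inj₁ a) (inj₁ b)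
    pendant : ∀ {a s} → toℕ a ≡ suc (toℕ s) → Arc (inj₁ a) (inj₂ s)

  Link : Node → Node → Set
  Link u v = Arc u v ⊎ Arc v u

  arc? : ∀ u v → Dec (Arc u v)
  arc? (inj₁ a) (inj₁ b) = Dec.map′ spine (λ { (spine e) → e }) (suc (toℕ a) ℕ.≟ toℕ b)
  arc? (inj₁ a) (inj₂ s) = Dec.map′ pendant (λ { (pendant e) → e }) (toℕ a ℕ.≟ suc (toℕ s))
  arc? (inj₂ s) v = no λ ()

  link? : ∀ u v → Dec (Link u v)
  link? u v = arc? u v ⊎-dec arc? v u

  ¬Arc-refl : ∀ {u} → ¬ Arc u u
  ¬Arc-refl (spine e) = ℕ.1+n≢n e

  node : Fin t → Node
  node = splitAt m

  vertex : Node → Fin t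
  vertex = join m k

  T : Graph t
  T = record
    { adj    = λ x y → does (link? (node x) (node y))
    ; sym    = λ x y → does-⇔ (mk⇔ Sum.swap Sum.swap) (link? (node x) (node y)) (link? (node y) (node x))
    ; irrefl = λ x → dec-false (link? (node x) (node x)) Sum.[ ¬Arc-refl , ¬Arc-refl ]
    }

  P : Fin m → Fin t
  P a = vertex (inj₁ a)

  node-vertex : ∀ u → node (vertex u) ≡ u
  node-vertex = Fin.splitAt-join m k

  vertex-node : ∀ x → vertex (node x) ≡ x
  vertex-node = Fin.join-splitAt m k

  vertex-injective : ∀ {u v} → vertex u ≡ vertex v → u ≡ v
  vertex-injective {u} {v} e = trans (sym (node-vertex u)) (trans (cong node e) (node-vertex v))

  adj⇔Link : ∀ {u v} → adj T (vertex u) (vertex v) ≡ true ⇔ Link u v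
  adj⇔Link {u} {v} rewrite node-vertex u | node-vertex v = does⇔ (link? u v)

  adj⇒Link : ∀ x y → adj T x y ≡ true → Link (node x) (node y)
  adj⇒Link x y = to (does⇔ (link? (node x) (node y)))

  Link⇒adj : ∀ {u v} → Link u v → adj T (vertex u) (vertex v) ≡ true
  Link⇒adj = from adj⇔Link

  data SpineNode : Fin m → Set where
    first : SpineNode zero
    inner : (s : Fin k) → SpineNode (suc (inject₁ s))
    last  : SpineNode (fromℕ (suc k))

  spineView : (a : Fin m) → SpineNode a
  spineView zero = first
  spineView (suc a) with view a
  ... | ‵fromℕ = last
  ... | ‵inject₁ s = inner s

  spineView-unique : ∀ {a} (v : SpineNode a) → spineView a ≡ v
  spineView-unique first = refl
  spineView-unique (inner s) rewrite view-inject₁ s = refl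
  spineView-unique last rewrite view-fromℕ k = refl

  leafIndex : Fin k → Fin m
  leafIndex s = suc (inject₁ s)

  leafOf : ∀ {a} → SpineNode a → Node
  leafOf first = inj₁ zero
  leafOf (inner s) = inj₂ s
  leafOf last = inj₁ (fromℕ (suc k))

  leafNode : Fin m → Node
  leafNode a = leafOf (spineView a)

  leaf : Fin m → Fin t
  leaf = vertex ∘ leafNode

  position-leafNode : ∀ x → position (leafNode x) ≡ toℕ x
  position-leafNode x with spineView x
  ... | first = refl
  ... | inner s = cong suc (sym (Fin.toℕ-inject₁ s))
  ... | last = refl

  leafNode-leafIndex : ∀ s → leafNode (leafIndex s) ≡ inj₂ s
  leafNode-leafIndex s rewrite spineView-unique (inner s) = refl

  leafNode≡pendant⇔ : ∀ x s → leafNode x ≡ inj₂ s ⇔ x ≡ leafIndex s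
  leafNode≡pendant⇔ x s = mk⇔
    (λ e → Fin.toℕ-injective (trans (sym (position-leafNode x))
             (trans (cong position e) (cong suc (sym (Fin.toℕ-inject₁ s))))))
    (λ { refl → leafNode-leafIndex s })

  leaf-injective : ∀ {x y} → leaf x ≡ leaf y → x ≡ y
  leaf-injective {x} {y} e = Fin.toℕ-injective (trans (sym (position-leafNode x))
    (trans (cong position (vertex-injective {leafNode x} {leafNode y} e)) (position-leafNode y)))

  neighboursOf : ∀ {a} → SpineNode a → List Node
  neighboursOf first = [ inj₁ (suc zero) ]
  neighboursOf (inner s) = inj₁ (inject₁ (inject₁ s)) ∷ inj₁ (suc (suc s)) ∷ inj₂ s ∷ []
  neighboursOf last = [ inj₁ (inject₁ (fromℕ k)) ]

  neighbours : Node → List Node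
  neighbours (inj₁ a) = neighboursOf (spineView a)
  neighbours (inj₂ s) = [ inj₁ (leafIndex s) ]

  Link⇒∈neighboursOf : ∀ {a} (w : SpineNode a) {v} → Link (inj₁ a) v → v ∈ neighboursOf w
  Link⇒∈neighboursOf first (inj₁ (spine e)) = here (cong inj₁ (Fin.toℕ-injective (sym e)))
  Link⇒∈neighboursOf first (inj₂ (spine ()))
  Link⇒∈neighboursOf first (inj₁ (pendant ()))
  Link⇒∈neighboursOf (inner s) (inj₁ (spine e)) =
    there (here (cong inj₁ (Fin.toℕ-injective (trans (sym e) (cong (λ n → suc (suc n)) (Fin.toℕ-inject₁ s))))))
  Link⇒∈neighboursOf (inner s) (inj₂ (spine e)) =
    here (cong inj₁ (Fin.toℕ-injective (trans (ℕ.suc-injective e) (sym (Fin.toℕ-inject₁ (inject₁ s))))))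
  Link⇒∈neighboursOf (inner s) (inj₁ (pendant e)) =
    there (there (here (cong inj₂ (Fin.toℕ-injective (trans (sym (ℕ.suc-injective e)) (Fin.toℕ-inject₁ s))))))
  Link⇒∈neighboursOf last {inj₁ b} (inj₁ (spine e)) =
    ⊥-elim (ℕ.<⇒≢ (Fin.toℕ<n b) (trans (sym e) (cong suc (Fin.toℕ-fromℕ (suc k)))))
  Link⇒∈neighboursOf last (inj₂ (spine e)) =
    here (cong inj₁ (Fin.toℕ-injective (trans (ℕ.suc-injective (trans e (Fin.toℕ-fromℕ (suc k))))
                                              (sym (trans (Fin.toℕ-inject₁ (fromℕ k)) (Fin.toℕ-fromℕ k))))))
  Link⇒∈neighboursOf last {inj₂ s} (inj₁ (pendant e)) =
    ⊥-elim (ℕ.<⇒≢ (Fin.toℕ<n s) (ℕ.suc-injective (trans (sym e) (Fin.toℕ-fromℕ (suc k)))))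

  ∈neighboursOf⇒Link : ∀ {a} (w : SpineNode a) {v} → v ∈ neighboursOf w → Link (inj₁ a) v
  ∈neighboursOf⇒Link first (here refl) = inj₁ (spine refl)
  ∈neighboursOf⇒Link (inner s) (here refl) = inj₂ (spine (cong suc (Fin.toℕ-inject₁ (inject₁ s))))
  ∈neighboursOf⇒Link (inner s) (there (here refl)) = inj₁ (spine (cong (λ n → suc (suc n)) (Fin.toℕ-inject₁ s)))
  ∈neighboursOf⇒Link (inner s) (there (there (here refl))) = inj₁ (pendant (cong suc (Fin.toℕ-inject₁ s)))
  ∈neighboursOf⇒Link last (here refl) = inj₂ (spine (cong suc (Fin.toℕ-inject₁ (fromℕ k))))

  Link⇔∈neighbours : ∀ u v → Link u v ⇔ v ∈ neighbours u
  Link⇔∈neighbours (inj₁ a) v = mk⇔ (Link⇒∈neighboursOf (spineView a)) (∈neighboursOf⇒Link (spineView a))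
  Link⇔∈neighbours (inj₂ s) v = mk⇔ neighbour link
    where
    neighbour : Link (inj₂ s) v → v ∈ neighbours (inj₂ s)
    neighbour (inj₂ (pendant e)) = here (cong inj₁ (Fin.toℕ-injective (trans e (cong suc (sym (Fin.toℕ-inject₁ s))))))
    link : v ∈ neighbours (inj₂ s) → Link (inj₂ s) v
    link (here refl) = inj₂ (pendant (cong suc (Fin.toℕ-inject₁ s)))

  neighbours-unique : ∀ u → Unique (neighbours u)
  neighbours-unique (inj₁ a) with spineView a
  ... | first = [] ∷ []
  ... | inner s = (apart ∷ (λ ()) ∷ []) ∷ ((λ ()) ∷ []) ∷ [] ∷ []
    where
    apart : inj₁ (inject₁ (inject₁ s)) ≢ inj₁ (suc (suc s))
    apart e = ℕ.m≢1+n+m (toℕ s) {1}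
      (trans (sym (trans (Fin.toℕ-inject₁ (inject₁ s)) (Fin.toℕ-inject₁ s))) (cong position e))
  ... | last = [] ∷ []
  neighbours-unique (inj₂ s) = [] ∷ []

  degree-vertex : ∀ u → degree T (vertex u) ≡ length (neighbours u)
  degree-vertex u = trans
    (countTrue-exactly (adj T (vertex u)) (map vertex (neighbours u))
      (Unique.map⁺ vertex-injective (neighbours-unique u)) adj⇔∈)
    (length-map vertex (neighbours u))
    where
    ∈-vertex⁻ : ∀ {v} → vertex v ∈ map vertex (neighbours u) → v ∈ neighbours u
    ∈-vertex⁻ v∈ with ∈-map⁻ vertex v∈
    ... | w , w∈ , v≡w = subst (_∈ neighbours u) (sym (vertex-injective v≡w)) w∈
    adj⇔∈ : ∀ y → adj T (vertex u) y ≡ true ⇔ y ∈ map vertex (neighbours u)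
    adj⇔∈ y = subst (λ y → adj T (vertex u) y ≡ true ⇔ y ∈ map vertex (neighbours u)) (vertex-node y)
      (mk⇔ (∈-map⁺ vertex ∘ to (Link⇔∈neighbours u (node y)) ∘ to adj⇔Link)
           (from adj⇔Link ∘ from (Link⇔∈neighbours u (node y)) ∘ ∈-vertex⁻))

  degree≡1⊎3 : ∀ x → degree T x ≡ 1 ⊎ degree T x ≡ 3
  degree≡1⊎3 x rewrite sym (vertex-node x) | degree-vertex (node x) = count (node x)
    where
    count : ∀ u → length (neighbours u) ≡ 1 ⊎ length (neighbours u) ≡ 3
    count (inj₁ a) with spineView a
    ... | first = inj₁ refl
    ... | inner s = inj₂ refl
    ... | last = inj₁ refl
    count (inj₂ s) = inj₁ refl

  degree-leaf : ∀ x → degree T (leaf x) ≡ 1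
  degree-leaf x = trans (degree-vertex (leafNode x)) (count x)
    where
    count : ∀ x → length (neighbours (leafNode x)) ≡ 1
    count x with spineView x
    ... | first = refl
    ... | inner s = refl
    ... | last rewrite spineView-unique last = refl

  leaf-surjective : ∀ y → degree T y ≡ 1 → ∃ λ x → leaf x ≡ y
  leaf-surjective y deg≡1
    with leafAt (node y) (trans (sym (degree-vertex (node y))) (subst (λ z → degree T z ≡ 1) (sym (vertex-node y)) deg≡1))
    where
    leafAt : ∀ u → length (neighbours u) ≡ 1 → ∃ λ x → leaf x ≡ vertex u
    leafAt (inj₁ a) len≡1 with spineView a
    ... | first = zero , refl
    ... | last = fromℕ (suc k) , cong (vertex ∘ leafOf) (spineView-unique last)
    leafAt (inj₂ s) _ = leafIndex s , cong vertex (leafNode-leafIndex s)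
  ... | x , leaf≡ = x , trans leaf≡ (vertex-node y)

  potential : Node → ℕ
  potential (inj₁ a) = suc (toℕ a + toℕ a)
  potential (inj₂ s) = suc (toℕ s) + suc (toℕ s)

  spine-potential : ∀ {a b} → suc (toℕ a) ≡ toℕ b → potential (inj₁ b) ≡ 2 + potential (inj₁ a)
  spine-potential {a} e rewrite sym e = cong (λ n → suc (suc n)) (ℕ.+-suc (toℕ a) (toℕ a))

  pendant-potential : ∀ {a s} → toℕ a ≡ suc (toℕ s) → potential (inj₁ a) ≡ suc (potential (inj₂ s))
  pendant-potential e rewrite e = refl

  Link⇒potential≢ : ∀ {u v} → Link u v → potential u ≢ potential v
  Link⇒potential≢ (inj₁ (spine e)) u≡v = ℕ.m≢1+n+m _ {1} (trans u≡v (spine-potential e))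
  Link⇒potential≢ (inj₂ (spine e)) u≡v = ℕ.m≢1+n+m _ {1} (trans (sym u≡v) (spine-potential e))
  Link⇒potential≢ (inj₁ (pendant e)) u≡v = ℕ.1+n≢n (trans (sym (pendant-potential e)) u≡v)
  Link⇒potential≢ (inj₂ (pendant e)) u≡v = ℕ.1+n≢n (trans (sym (pendant-potential e)) (sym u≡v))

  above : Node → ℕ
  above (inj₁ a) = suc (toℕ a)
  above (inj₂ s) = suc (toℕ s)

  higherNeighbour : ∀ {u v} → Link u v → potential u < potential v → ∃ λ b → v ≡ inj₁ b × toℕ b ≡ above u
  higherNeighbour (inj₁ (spine e)) _ = _ , refl , sym e
  higherNeighbour (inj₁ (pendant {s = s} e)) u<v =
    ⊥-elim (ℕ.<-asym u<v (subst (potential (inj₂ s) <_) (sym (pendant-potential e)) ℕ.≤-refl))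
  higherNeighbour (inj₂ (spine {a} e)) u<v =
    ⊥-elim (ℕ.<-asym u<v (subst (potential (inj₁ a) <_) (sym (spine-potential e)) (s≤s (ℕ.n≤1+n _))))
  higherNeighbour (inj₂ (pendant e)) _ = _ , refl , e

  acyclic : ¬ HasCycle T
  acyclic = ¬HasCycle-byPotential T (potential ∘ node) (λ x y → Link⇒potential≢ ∘ adj⇒Link x y) unique
    where
    unique : ∀ x y z → adj T x y ≡ true → adj T x z ≡ true →
             potential (node x) < potential (node y) → potential (node x) < potential (node z) → y ≡ z
    unique x y z xy xz x<y x<z with higherNeighbour (adj⇒Link x y xy) x<y | higherNeighbour (adj⇒Link x z xz) x<z
    ... | b , y≡ , b≡ | c , z≡ , c≡ = trans (sym (vertex-node y)) (trans (cong vertex (trans y≡ (trans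
            (cong inj₁ (Fin.toℕ-injective (trans b≡ (sym c≡)))) (sym z≡)))) (vertex-node z))

  Between : ℕ → ℕ → ℕ → Set
  Between p q i = (p ≤ i × i ≤ q) ⊎ (q ≤ i × i ≤ p)

  between-right : ∀ p q → Between p q q
  between-right p q with ℕ.≤-total p q
  ... | inj₁ p≤q = inj₁ (p≤q , ℕ.≤-refl)
  ... | inj₂ q≤p = inj₂ (ℕ.≤-refl , q≤p)

  module Within {A B : Fin t} (U : Node → Set)
    (safe : ∀ {u v} → Link u v → U u → U v → ¬ Traverses A B (vertex u) (vertex v)) where

    stepᵁ : ∀ {u v z} → Link u v → U u → U v → WalkAvoiding T A B (vertex v) z → WalkAvoiding T A B (vertex u) z
    stepᵁ uv Uu Uv = step (Link⇒adj uv) (safe uv Uu Uv)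

    spineUp : ∀ d (a b : Fin m) → toℕ b ≡ d + toℕ a →
              (∀ i → toℕ a ≤ toℕ i → toℕ i ≤ toℕ b → U (inj₁ i)) → WalkAvoiding T A B (P a) (P b)
    spineUp zero a b b≡a inRange rewrite Fin.toℕ-injective b≡a = here
    spineUp (suc d) a b b≡ inRange =
      stepᵁ (inj₁ (spine (sym a′≡))) (inRange a ℕ.≤-refl (ℕ.≤-trans (ℕ.n≤1+n _) a<b)) (inRange a′ a≤a′ a′≤b)
            (spineUp d a′ b b≡′ λ i a′≤i i≤b → inRange i (ℕ.≤-trans a≤a′ a′≤i) i≤b)
      where
      a<b : suc (toℕ a) ≤ toℕ b
      a<b = subst (suc (toℕ a) ≤_) (sym b≡) (s≤s (ℕ.m≤n+m _ d))
      a+1<m : suc (toℕ a) < m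
      a+1<m = ℕ.≤-<-trans a<b (Fin.toℕ<n b)
      a′ : Fin m
      a′ = fromℕ< a+1<m
      a′≡ : toℕ a′ ≡ suc (toℕ a)
      a′≡ = Fin.toℕ-fromℕ< a+1<m
      a≤a′ : toℕ a ≤ toℕ a′
      a≤a′ = subst (toℕ a ≤_) (sym a′≡) (ℕ.n≤1+n _)
      a′≤b : toℕ a′ ≤ toℕ b
      a′≤b = subst (_≤ toℕ b) (sym a′≡) a<b
      b≡′ : toℕ b ≡ d + toℕ a′
      b≡′ = trans b≡ (trans (sym (ℕ.+-suc d (toℕ a))) (cong (d +_) (sym a′≡)))

    spineWalk : ∀ a b → (∀ i → Between (toℕ a) (toℕ b) (toℕ i) → U (inj₁ i)) → WalkAvoiding T A B (P a) (P b)
    spineWalk a b inRange with ℕ.≤-total (toℕ a) (toℕ b)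
    ... | inj₁ a≤b = spineUp (toℕ b ∸ toℕ a) a b (sym (ℕ.m∸n+n≡m a≤b)) λ i lo hi → inRange i (inj₁ (lo , hi))
    ... | inj₂ b≤a = walkAvoiding-reverse
      (spineUp (toℕ a ∸ toℕ b) b a (sym (ℕ.m∸n+n≡m b≤a)) λ i lo hi → inRange i (inj₂ (lo , hi)))

    hang : ∀ x → U (inj₁ x) → U (leafNode x) → WalkAvoiding T A B (P x) (leaf x)
    hang x Ux Uleaf with spineView x
    ... | first = here
    ... | inner s = stepᵁ (inj₁ (pendant (cong suc (Fin.toℕ-inject₁ s)))) Ux Uleaf here
    ... | last = here

    toLeaf : ∀ a x → (∀ i → Between (toℕ a) (toℕ x) (toℕ i) → U (inj₁ i)) → U (leafNode x) →
             WalkAvoiding T A B (P a) (leaf x)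
    toLeaf a x inRange Uleaf =
      walkAvoiding-++ (spineWalk a x inRange) (hang x (inRange x (between-right (toℕ a) (toℕ x))) Uleaf)

  connected : Connected T
  connected x y = walkAvoiding⇒walk (walkAvoiding-++ (walkAvoiding-reverse (fromRoot x)) (fromRoot y))
    where
    -- No walk traverses the non-edge {P 0 , P 0}.
    open Within {P zero} {P zero} (λ _ → ⊤) (λ uv _ _ → ¬Traverses-loop {T = T} (Link⇒adj uv))
    fromRootᴺ : ∀ u → WalkAvoiding T (P zero) (P zero) (P zero) (vertex u)
    fromRootᴺ (inj₁ a) = spineUp (toℕ a) zero a (sym (ℕ.+-identityʳ _)) _
    fromRootᴺ (inj₂ s) = subst (WalkAvoiding T (P zero) (P zero) (P zero) ∘ vertex) (leafNode-leafIndex s)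
                               (toLeaf zero (leafIndex s) _ _)
    fromRoot : ∀ x → WalkAvoiding T (P zero) (P zero) (P zero) x
    fromRoot x = subst (WalkAvoiding T (P zero) (P zero) (P zero)) (vertex-node x) (fromRootᴺ (node x))

  Side : Fin t → Fin t → Fin m → Set
  Side u v x = WalkAvoiding T u v u (leaf x)

  module _ {u₀ v₀ : Node} where

    side-invariant : (R : Node → Set) → (∀ {u v} → Link u v → R u → R v ⊎ (u ≡ u₀ × v ≡ v₀)) →
                     R u₀ → ∀ x → Side (vertex u₀) (vertex v₀) x → R (leafNode x)
    side-invariant R closed Ru₀ x side =
      subst R (node-vertex (leafNode x))
        (walkAvoiding-preserves (R ∘ node) step-preserves side (subst R (sym (node-vertex u₀)) Ru₀))
      where
      step-preserves : ∀ x y → adj T x y ≡ true → ¬ Traverses (vertex u₀) (vertex v₀) x y → R (node x) → R (node y)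
      step-preserves x y xy ¬u₀v₀ Rx with closed (adj⇒Link x y xy) Rx
      ... | inj₁ Ry = Ry
      ... | inj₂ (x≡ , y≡) = ⊥-elim (¬u₀v₀ (inj₁ (trans (sym (vertex-node x)) (cong vertex x≡) ,
                                                  trans (sym (vertex-node y)) (cong vertex y≡))))

    excluding : (U : Node → Set) → ¬ U v₀ → ∀ {u v} → Link u v → U u → U v →
                ¬ Traverses (vertex u₀) (vertex v₀) (vertex u) (vertex v)
    excluding U ¬Uv₀ _ Uu Uv (inj₁ (_ , v≡)) = ¬Uv₀ (subst U (vertex-injective v≡) Uv)
    excluding U ¬Uv₀ _ Uu Uv (inj₂ (u≡ , _)) = ¬Uv₀ (subst U (vertex-injective u≡) Uu)

  module _ {a b : Fin m} (a+1≡b : suc (toℕ a) ≡ toℕ b) where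

    b≰a : ¬ toℕ b ≤ toℕ a
    b≰a b≤a = ℕ.<-irrefl refl (subst (_≤ toℕ a) (sym a+1≡b) b≤a)

    below-closed : ∀ {u v} → Link u v → position u ≤ toℕ a → position v ≤ toℕ a ⊎ (u ≡ inj₁ a × v ≡ inj₁ b)
    below-closed (inj₁ (spine {c} {d} c+1≡d)) c≤a with ℕ.m≤n⇒m<n∨m≡n c≤a
    ... | inj₁ c<a = inj₁ (subst (_≤ toℕ a) c+1≡d c<a)
    ... | inj₂ c≡a = inj₂ (cong inj₁ (Fin.toℕ-injective c≡a) ,
                           cong inj₁ (Fin.toℕ-injective (trans (sym c+1≡d) (trans (cong suc c≡a) a+1≡b))))
    below-closed (inj₂ (spine c+1≡d)) d≤a = inj₁ (ℕ.≤-trans (subst (_ ≤_) c+1≡d (ℕ.n≤1+n _)) d≤a)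
    below-closed (inj₁ (pendant e)) c≤a = inj₁ (subst (_≤ toℕ a) e c≤a)
    below-closed (inj₂ (pendant e)) s<a = inj₁ (subst (_≤ toℕ a) (sym e) s<a)

    above-closed : ∀ {u v} → Link u v → toℕ b ≤ position u → toℕ b ≤ position v ⊎ (u ≡ inj₁ b × v ≡ inj₁ a)
    above-closed (inj₁ (spine c+1≡d)) b≤c = inj₁ (ℕ.≤-trans b≤c (subst (_ ≤_) c+1≡d (ℕ.n≤1+n _)))
    above-closed (inj₂ (spine {c} {d} c+1≡d)) b≤d with ℕ.m≤n⇒m<n∨m≡n b≤d
    ... | inj₁ b<d = inj₁ (ℕ.≤-pred (subst (_ ≤_) (sym c+1≡d) b<d))
    ... | inj₂ b≡d = inj₂ (cong inj₁ (Fin.toℕ-injective (sym b≡d)) ,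
                           cong inj₁ (Fin.toℕ-injective (ℕ.suc-injective (trans c+1≡d (trans (sym b≡d) (sym a+1≡b))))))
    above-closed (inj₁ (pendant e)) b≤c = inj₁ (subst (toℕ b ≤_) e b≤c)
    above-closed (inj₂ (pendant e)) b≤s = inj₁ (subst (toℕ b ≤_) (sym e) b≤s)

    side-below : ∀ x → Side (P a) (P b) x ⇔ toℕ x < toℕ b
    side-below x = mk⇔
      (λ side → subst (suc (toℕ x) ≤_) a+1≡b (s≤s (subst (_≤ toℕ a) (position-leafNode x)
                  (side-invariant (λ w → position w ≤ toℕ a) below-closed ℕ.≤-refl x side))))
      (λ x<b → let x≤a = ℕ.≤-pred (subst (suc (toℕ x) ≤_) (sym a+1≡b) x<b) in
        toLeaf a x (inRange x≤a) (subst (_≤ toℕ a) (sym (position-leafNode x)) x≤a))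
      where
      open Within (λ w → position w ≤ toℕ a) (excluding {inj₁ a} _ b≰a)
      inRange : toℕ x ≤ toℕ a → ∀ i → Between (toℕ a) (toℕ x) (toℕ i) → toℕ i ≤ toℕ a
      inRange x≤a i (inj₁ (_ , i≤x)) = ℕ.≤-trans i≤x x≤a
      inRange x≤a i (inj₂ (_ , i≤a)) = i≤a

    side-above : ∀ x → Side (P b) (P a) x ⇔ toℕ b ≤ toℕ x
    side-above x = mk⇔
      (λ side → subst (toℕ b ≤_) (position-leafNode x)
                  (side-invariant (λ w → toℕ b ≤ position w) above-closed ℕ.≤-refl x side))
      (λ b≤x → toLeaf b x (inRange b≤x) (subst (toℕ b ≤_) (sym (position-leafNode x)) b≤x))
      where
      open Within (λ w → toℕ b ≤ position w) (excluding {inj₁ b} _ b≰a)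
      inRange : toℕ b ≤ toℕ x → ∀ i → Between (toℕ b) (toℕ x) (toℕ i) → toℕ b ≤ toℕ i
      inRange b≤x i (inj₁ (b≤i , _)) = b≤i
      inRange b≤x i (inj₂ (x≤i , _)) = ℕ.≤-trans b≤x x≤i

  module _ {a : Fin m} {s : Fin k} (a≡s+1 : toℕ a ≡ suc (toℕ s)) where

    pendant-only-neighbour : ∀ {v} → Link (inj₂ s) v → v ≡ inj₁ a
    pendant-only-neighbour (inj₂ (pendant e)) = cong inj₁ (Fin.toℕ-injective (trans e (sym a≡s+1)))

    side-pendant : ∀ x → Side (vertex (inj₂ s)) (P a) x ⇔ x ≡ leafIndex s
    side-pendant x = mk⇔
      (λ side → to (leafNode≡pendant⇔ x s) (side-invariant (_≡ inj₂ s) closed refl x side))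
      (λ { refl → subst (WalkAvoiding T (vertex (inj₂ s)) (P a) (vertex (inj₂ s)) ∘ vertex)
                        (sym (leafNode-leafIndex s)) here })
      where
      closed : ∀ {u v} → Link u v → u ≡ inj₂ s → v ≡ inj₂ s ⊎ (u ≡ inj₂ s × v ≡ inj₁ a)
      closed uv refl = inj₂ (refl , pendant-only-neighbour uv)

    side-spine : ∀ x → Side (P a) (vertex (inj₂ s)) x ⇔ x ≢ leafIndex s
    side-spine x = mk⇔
      (λ side x≡ → side-invariant (_≢ inj₂ s) closed (λ ()) x side (from (leafNode≡pendant⇔ x s) x≡))
      (λ x≢ → toLeaf a x (λ _ _ ()) (x≢ ∘ to (leafNode≡pendant⇔ x s)))
      where
      open Within (_≢ inj₂ s) (excluding {inj₁ a} _ (λ s≢s → s≢s refl))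
      closed : ∀ {u v} → Link u v → u ≢ inj₂ s → v ≢ inj₂ s ⊎ (u ≡ inj₁ a × v ≡ inj₂ s)
      closed (inj₁ (pendant {s = s′} e)) _ with s′ Fin.≟ s
      ... | yes refl = inj₂ (pendant-only-neighbour (inj₂ (pendant e)) , refl)
      ... | no s′≢s = inj₁ (s′≢s ∘ Sum.inj₂-injective)
      closed (inj₁ (spine _)) _ = inj₁ λ ()
      closed (inj₂ (spine _)) _ = inj₁ λ ()
      closed (inj₂ (pendant _)) _ = inj₁ λ ()

  module _ (H : Graph m) (r : ℕ)
           (prefix : ∀ j → CutRk≤ H (λ x → toℕ x < j) (suc r))
           (suffix : ∀ j → CutRk≤ H (λ x → j ≤ toℕ x) (suc r)) where

    width-Link : ∀ {u v} → Link u v → CutRk≤ H (Side (vertex u) (vertex v)) (suc r)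
    width-Link (inj₁ (spine e)) = CutRk≤-cong H (⇔.sym ∘ side-below e) (prefix _)
    width-Link (inj₂ (spine e)) = CutRk≤-cong H (⇔.sym ∘ side-above e) (suffix _)
    width-Link (inj₁ (pendant {s = s} e)) = CutRk≤-cong H (⇔.sym ∘ side-spine e) (CutRk≤-cosingleton H (leafIndex s) r)
    width-Link (inj₂ (pendant {s = s} e)) = CutRk≤-cong H (⇔.sym ∘ side-pendant e) (CutRk≤-singleton H (leafIndex s) r)

    decomposition : RankDecomposition H T (suc r)
    decomposition = record
      { tree     = connected , acyclic
      ; degrees  = degree≡1⊎3
      ; leaf     = leaf
      ; leafInj  = leaf-injective
      ; leafDeg  = degree-leaf
      ; leafSurj = leaf-surjective
      ; width    = λ x y xy → subst₂ (λ x y → CutRk≤ H (Side x y) (suc r)) (vertex-node x) (vertex-node y)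
                                     (width-Link (adj⇒Link x y xy))
      }

linearCuts⇒RankWidth≤ : ∀ {n} (H : Graph n) r →
  (∀ j → CutRk≤ H (λ x → toℕ x < j) (suc r)) → (∀ j → CutRk≤ H (λ x → j ≤ toℕ x) (suc r)) →
  RankWidth≤ H (suc r)
linearCuts⇒RankWidth≤ {zero} _ _ _ _ = inj₁ z≤n
linearCuts⇒RankWidth≤ {suc zero} _ _ _ _ = inj₁ (s≤s z≤n)
linearCuts⇒RankWidth≤ {suc (suc k)} H r prefix suffix =
  inj₂ (_ , Caterpillar.T k , Caterpillar.decomposition k H r prefix suffix)

infix 4 _≤ₗ_ _<ₗ_

_≤ₗ_ _<ₗ_ : List ℚ → List ℚ → Set
_≤ₗ_ = Lex-≤ _≡_ _<ℚ_
_<ₗ_ = Lex-< _≡_ _<ℚ_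

<ₗ⇒≱ₗ : ∀ {xs ys} → xs <ₗ ys → ¬ ys ≤ₗ xs
<ₗ⇒≱ₗ (base ())
<ₗ⇒≱ₗ halt ()
<ₗ⇒≱ₗ (this x<y) (this y<x) = ℚ.<-asym x<y y<x
<ₗ⇒≱ₗ (this x<y) (next refl _) = ℚ.<-irrefl refl x<y
<ₗ⇒≱ₗ (next refl _) (this y<x) = ℚ.<-irrefl refl y<x
<ₗ⇒≱ₗ (next refl xs<ys) (next refl ys≤xs) = <ₗ⇒≱ₗ xs<ys ys≤xs

≤ₗ⇒<ₗ∷ʳ : ∀ {xs ys} → length xs ≡ length ys → xs ≤ₗ ys → ∀ c → xs <ₗ ys ∷ʳ c
≤ₗ⇒<ₗ∷ʳ _ (base _) c = halt
≤ₗ⇒<ₗ∷ʳ () halt c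
≤ₗ⇒<ₗ∷ʳ _ (this x<y) c = this x<y
≤ₗ⇒<ₗ∷ʳ len (next x≡y xs≤ys) c = next x≡y (≤ₗ⇒<ₗ∷ʳ (ℕ.suc-injective len) xs≤ys c)

<ₗ⇒∷ʳ<ₗ : ∀ {xs ys} → length xs ≡ length ys → xs <ₗ ys → ∀ c → xs ∷ʳ c <ₗ ys
<ₗ⇒∷ʳ<ₗ _ (base ()) c
<ₗ⇒∷ʳ<ₗ () halt c
<ₗ⇒∷ʳ<ₗ _ (this x<y) c = this x<y
<ₗ⇒∷ʳ<ₗ len (next x≡y xs<ys) c = next x≡y (<ₗ⇒∷ʳ<ₗ (ℕ.suc-injective len) xs<ys c)

∷ʳ-mono-≤ₗ : ∀ {xs ys} → length xs ≡ length ys → xs ≤ₗ ys →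
             ∀ {c c′} → c ≤ℚ c′ → xs ∷ʳ c ≤ₗ ys ∷ʳ c′
∷ʳ-mono-≤ₗ _ (base _) {c} {c′} c≤c′ with ℚ.<-cmp c c′
... | tri< c<c′ _ _ = this c<c′
... | tri≈ _ refl _ = next refl (base _)
... | tri> _ _ c′<c = ⊥-elim (ℚ.<-irrefl refl (ℚ.<-≤-trans c′<c c≤c′))
∷ʳ-mono-≤ₗ () halt c≤c′
∷ʳ-mono-≤ₗ _ (this x<y) c≤c′ = this x<y
∷ʳ-mono-≤ₗ len (next x≡y xs≤ys) c≤c′ = next x≡y (∷ʳ-mono-≤ₗ (ℕ.suc-injective len) xs≤ys c≤c′)

∷ʳ-mono-<ₗ : ∀ {xs ys} → length xs ≡ length ys → xs ≤ₗ ys →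
             ∀ {c c′} → c <ℚ c′ → xs ∷ʳ c <ₗ ys ∷ʳ c′
∷ʳ-mono-<ₗ _ (base _) c<c′ = this c<c′
∷ʳ-mono-<ₗ () halt c<c′
∷ʳ-mono-<ₗ _ (this x<y) c<c′ = this x<y
∷ʳ-mono-<ₗ len (next x≡y xs≤ys) c<c′ = next x≡y (∷ʳ-mono-<ₗ (ℕ.suc-injective len) xs≤ys c<c′)

-- Linear orders of bounded cut-rank

lookup-injective : ∀ {A : Set} (xs : List A) → Unique xs → Injective _≡_ _≡_ (lookup xs)
lookup-injective (x ∷ xs) (x∉xs ∷ _) {zero} {zero} _ = refl
lookup-injective (x ∷ xs) (x∉xs ∷ _) {zero} {suc j} x≡ = ⊥-elim (All.lookup x∉xs (∈-lookup j) x≡)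
lookup-injective (x ∷ xs) (x∉xs ∷ _) {suc i} {zero} ≡x = ⊥-elim (All.lookup x∉xs (∈-lookup i) (sym ≡x))
lookup-injective (x ∷ xs) (_ ∷ unique) {suc i} {suc j} e = cong suc (lookup-injective xs unique e)

module SortedEnumeration {a ℓ₁ ℓ₂} {n} {S : Fin n → Set} (S? : Decidable S)
                         (O : DecTotalOrder a ℓ₁ ℓ₂) (K : Fin n → DecTotalOrder.Carrier O) where

  open DecTotalOrder O using () renaming (_≤_ to _≼_)
  private
    Oᴷ = On.decTotalOrder O K
  open import Data.List.Sort Oᴷ using (sort; sort-↭; sort-↗)
  open import Data.List.Relation.Unary.Sorted.TotalOrder.Properties using (lookup-mono-≤)

  elements : List (Fin n)
  elements = sort (filter S? (allFin n))

  size : ℕ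
  size = length elements

  enum : Fin size → Fin n
  enum = lookup elements

  enum-injective : Injective _≡_ _≡_ enum
  enum-injective = lookup-injective elements
    (Permutation.Unique-resp-↭ (setoid (Fin n)) (↭⇒↭ₛ (↭-sym (sort-↭ _))) (Unique.filter⁺ S? (Unique.allFin⁺ n)))

  enum-image : ∀ x → S x ⇔ ∃ λ i → enum i ≡ x
  enum-image x = mk⇔
    (λ Sx → let x∈ = ∈-resp-↭ (↭-sym (sort-↭ _)) (∈-filter⁺ S? (∈-allFin x) Sx) in index x∈ , sym (lookup-index x∈))
    (λ { (i , refl) → proj₂ (∈-filter⁻ S? {xs = allFin n} (∈-resp-↭ (sort-↭ _) (∈-lookup i))) })

  enum-sorted : ∀ {i j} → toℕ i ≤ toℕ j → K (enum i) ≼ K (enum j)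
  enum-sorted = lookup-mono-≤ (DecTotalOrder.totalOrder Oᴷ) (sort-↗ _)

≟-sym : ∀ (a b : ℕ) → does (a ℕ.≟ b) ≡ does (b ℕ.≟ a)
≟-sym a b = does-⇔ (mk⇔ sym sym) (a ℕ.≟ b) (b ℕ.≟ a)

-- A row of X vanishes across the cut unless its block is γ, and then it depends only on its type.
CutRk≤-byBlocks : ∀ {m} (H : Graph m) {T} (X : Fin m → Set) (block : Fin m → ℕ) (type : Fin m → Fin T)
  (Ψ : Fin T → Fin T → Bool) (γ : ℕ) →
  (∀ x y → X x → ¬ X y → adj H x y ≡ does (block x ℕ.≟ block y) ∧ Ψ (type x) (type y)) →
  (∀ x y → X x → ¬ X y → block x ≡ block y → block x ≡ γ) →
  CutRk≤ H X T
CutRk≤-byBlocks H X block type Ψ γ adj≡ sameBlock⇒γ =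
  CutRk≤-fromRows H (λ t y → does (γ ℕ.≟ block y) ∧ Ψ t (type y)) rows
  where
  rows : ∀ x → X x → (∀ y → ¬ X y → adj H x y ≡ false) ⊎
                      (∃ λ t → ∀ y → ¬ X y → adj H x y ≡ does (γ ℕ.≟ block y) ∧ Ψ t (type y))
  rows x Xx with block x ℕ.≟ γ
  ... | yes refl = inj₂ (type x , λ y → adj≡ x y Xx)
  ... | no bx≢γ = inj₁ λ y ¬Xy → trans (adj≡ x y Xx ¬Xy)
                    (cong (_∧ Ψ (type x) (type y)) (dec-false (block x ℕ.≟ block y) (bx≢γ ∘ sameBlock⇒γ x y Xx ¬Xy)))

module _ {m} (H : Graph m) {T : ℕ} (block : Fin m → ℕ) (type : Fin m → Fin (suc T))
         (Φ : Fin (suc T) → Fin (suc T) → Bool)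
         (block-mono : ∀ x y → toℕ x ≤ toℕ y → block x ≤ block y)
         (adj≡ : ∀ x y → toℕ x < toℕ y → adj H x y ≡ does (block x ℕ.≟ block y) ∧ Φ (type x) (type y)) where

  prefix-cut : ∀ j → CutRk≤ H (λ x → toℕ x < j) (suc T)
  prefix-cut j with j ℕ.<? m
  ... | no j≮m = CutRk≤-fromRows H (λ _ _ → false) λ _ _ →
                   inj₁ λ y y≮j → ⊥-elim (y≮j (ℕ.<-≤-trans (Fin.toℕ<n y) (ℕ.≮⇒≥ j≮m)))
  ... | yes j<m = CutRk≤-byBlocks H _ block type Φ (block p)
                    (λ x y x<j y≮j → adj≡ x y (ℕ.<-≤-trans x<j (ℕ.≮⇒≥ y≮j))) squeeze
    where
    p : Fin m
    p = fromℕ< j<m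
    squeeze : ∀ x y → toℕ x < j → ¬ toℕ y < j → block x ≡ block y → block x ≡ block p
    squeeze x y x<j y≮j bx≡by = ℕ.≤-antisym (block-mono x p x≤p) (subst (block p ≤_) (sym bx≡by) (block-mono p y p≤y))
      where
      x≤p : toℕ x ≤ toℕ p
      x≤p = subst (toℕ x ≤_) (sym (Fin.toℕ-fromℕ< j<m)) (ℕ.<⇒≤ x<j)
      p≤y : toℕ p ≤ toℕ y
      p≤y = subst (_≤ toℕ y) (sym (Fin.toℕ-fromℕ< j<m)) (ℕ.≮⇒≥ y≮j)

  suffix-cut : ∀ j → CutRk≤ H (λ x → j ≤ toℕ x) (suc T)
  suffix-cut j with j ℕ.<? m
  ... | no j≮m = CutRk≤-fromRows H (λ _ _ → false) λ x j≤x → ⊥-elim (j≮m (ℕ.≤-<-trans j≤x (Fin.toℕ<n x)))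
  ... | yes j<m = CutRk≤-byBlocks H _ block type (λ t t′ → Φ t′ t) (block p) adj≡′ squeeze
    where
    p : Fin m
    p = fromℕ< j<m
    adj≡′ : ∀ x y → j ≤ toℕ x → ¬ j ≤ toℕ y → adj H x y ≡ does (block x ℕ.≟ block y) ∧ Φ (type y) (type x)
    adj≡′ x y j≤x j≰y = begin
      adj H x y                                           ≡⟨ adj-sym H x y ⟩
      adj H y x                                           ≡⟨ adj≡ y x (ℕ.<-≤-trans (ℕ.≰⇒> j≰y) j≤x) ⟩
      does (block y ℕ.≟ block x) ∧ Φ (type y) (type x)    ≡⟨ cong (_∧ Φ (type y) (type x)) (≟-sym (block y) (block x)) ⟩
      does (block x ℕ.≟ block y) ∧ Φ (type y) (type x)    ∎
      where open ≡-Reasoning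
    squeeze : ∀ x y → j ≤ toℕ x → ¬ j ≤ toℕ y → block x ≡ block y → block x ≡ block p
    squeeze x y j≤x j≰y bx≡by = ℕ.≤-antisym (subst (_≤ block p) (sym bx≡by) (block-mono y p y≤p)) (block-mono p x p≤x)
      where
      y≤p : toℕ y ≤ toℕ p
      y≤p = subst (toℕ y ≤_) (sym (Fin.toℕ-fromℕ< j<m)) (ℕ.<⇒≤ (ℕ.≰⇒> j≰y))
      p≤x : toℕ p ≤ toℕ x
      p≤x = subst (_≤ toℕ x) (sym (Fin.toℕ-fromℕ< j<m)) j≤x

  typed⇒RankWidth≤ : RankWidth≤ H (suc T)
  typed⇒RankWidth≤ = linearCuts⇒RankWidth≤ H T prefix-cut suffix-cut

module _ {a ℓ₁ ℓ₂} {n} (G : Graph n) {S : Fin n → Set} (S? : Decidable S)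
         (O : DecTotalOrder a ℓ₁ ℓ₂) (K : Fin n → DecTotalOrder.Carrier O) where

  open DecTotalOrder O using () renaming (_≤_ to _≼_)

  keyTyped⇒InducedRankWidth≤ : ∀ {T} (block : Fin n → ℕ) (type : Fin n → Fin (suc T))
    (Φ : Fin (suc T) → Fin (suc T) → Bool) →
    (∀ u v → K u ≼ K v → block u ≤ block v) →
    (∀ u v → S u → S v → u ≢ v → K u ≼ K v → adj G u v ≡ does (block u ℕ.≟ block v) ∧ Φ (type u) (type v)) →
    InducedRankWidth≤ G S (suc T)
  keyTyped⇒InducedRankWidth≤ block type Φ block-mono adj≡ =
    size , enum , enum-injective , enum-image ,
    typed⇒RankWidth≤ (induced G enum) (block ∘ enum) (type ∘ enum) Φ
      (λ x y x≤y → block-mono _ _ (enum-sorted x≤y))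
      (λ x y x<y → adj≡ (enum x) (enum y) (chosen x) (chosen y)
                        (λ e → ℕ.<⇒≢ x<y (cong toℕ (enum-injective e))) (enum-sorted (ℕ.<⇒≤ x<y)))
    where
    open SortedEnumeration S? O K
    chosen : ∀ i → S (enum i)
    chosen i = Equivalence.from (enum-image (enum i)) (i , refl)

-- Layered graphs

max : ∀ {n} → (Fin n → ℕ) → ℕ
max {zero} f = 0
max {suc n} f = f zero ⊔ max (f ∘ suc)

≤-max : ∀ {n} (f : Fin n → ℕ) w → f w ≤ max f
≤-max f zero = ℕ.m≤m⊔n _ _
≤-max f (suc w) = ℕ.≤-trans (≤-max (f ∘ suc) w) (ℕ.m≤n⊔m _ _)

max-attained : ∀ {n} (f : Fin n → ℕ) → max f ≡ 0 ⊎ ∃ λ w → max f ≡ f w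
max-attained {zero} f = inj₁ refl
max-attained {suc n} f with ℕ.⊔-sel (f zero) (max (f ∘ suc))
... | inj₁ ≡f0 = inj₂ (zero , ≡f0)
... | inj₂ ≡rest with max-attained (f ∘ suc)
...   | inj₁ ≡0 = inj₁ (trans ≡rest ≡0)
...   | inj₂ (w , ≡fw) = inj₂ (suc w , trans ≡rest ≡fw)

max-cong : ∀ {n} {f g : Fin n → ℕ} → (∀ i → f i ≡ g i) → max f ≡ max g
max-cong {zero} f≗g = refl
max-cong {suc n} f≗g = cong₂ _⊔_ (f≗g zero) (max-cong (f≗g ∘ suc))

argmax : ∀ {n} (pos : Fin n → ℚ) {P : Fin n → Set} → Decidable P →
         (Σ (Fin n) λ w → P w × ∀ w′ → P w′ → pos w′ ≤ℚ pos w) ⊎ (∀ w → ¬ P w)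
argmax {zero} pos P? = inj₂ λ ()
argmax {suc n} pos P? with argmax (pos ∘ suc) (P? ∘ suc) | P? zero
... | inj₂ none | no ¬P0 = inj₂ λ { zero → ¬P0 ; (suc w) → none w }
... | inj₂ none | yes P0 = inj₁ (zero , P0 , λ { zero _ → ℚ.≤-refl ; (suc w) Pw → ⊥-elim (none w Pw) })
... | inj₁ (w , Pw , w-max) | no ¬P0 = inj₁ (suc w , Pw , λ { zero P0 → ⊥-elim (¬P0 P0) ; (suc w′) → w-max w′ })
... | inj₁ (w , Pw , w-max) | yes P0 with pos zero ℚ.≤? pos (suc w)
...   | yes p0≤ = inj₁ (suc w , Pw , λ { zero _ → p0≤ ; (suc w′) → w-max w′ })
...   | no p0≰ = inj₁ (zero , P0 , λ { zero _ → ℚ.≤-refl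
                                     ; (suc w′) Pw′ → ℚ.≤-trans (w-max w′ Pw′) (ℚ.<⇒≤ (ℚ.≰⇒> p0≰)) })

-- u ≺ v reads "u lies strictly to the left of v".  The sides encode the bipartition: unit interval
-- graphs put every vertex on one side, compatible with itself; bipartite permutation graphs use the
-- colour classes, and only different colours are compatible.
record Layered {n} (G : Graph n) : Set₁ where
  field
    side              : Fin n → Bool
    compatible        : Bool → Bool → Bool
    pos               : Fin n → ℚ
    _≺_               : Fin n → Fin n → Set
    _≺?_              : Binary.Decidable _≺_
    potential         : Fin n → ℕ
    ≺⇒potential<      : ∀ {u v} → u ≺ v → potential u < potential v
    adj⇒compatible    : ∀ {u v} → adj G u v ≡ true → compatible (side u) (side v) ≡ true
    ≺⇒compatible      : ∀ {u v} → u ≺ v → compatible (side u) (side v) ≡ true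
    adj⇒¬≺            : ∀ {u v} → adj G u v ≡ true → ¬ u ≺ v
    ¬adj⇒≺            : ∀ {u v} → u ≢ v → compatible (side u) (side v) ≡ true → adj G u v ≡ false → u ≺ v ⊎ v ≺ u
    ≺-≺-adj⇒≺         : ∀ {z w u v} → z ≺ w → w ≺ u → adj G u v ≡ true → z ≺ v
    ≺-closedˡ         : ∀ {w v x} → w ≺ v → side x ≡ side w → pos x ≤ℚ pos w → x ≺ v
    ≺-closedʳ         : ∀ {w v v′} → w ≺ v → side v ≡ side v′ → pos v ≤ℚ pos v′ → w ≺ v′
    compatible⇒≺-side : ∀ {w v x} → w ≺ v → compatible (side x) (side v) ≡ true → side x ≡ side w

AtOrJustBelow : ℕ → ℕ → Set
AtOrJustBelow a b = b ≡ a ⊎ suc b ≡ a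

atOrJustBelow? : Binary.Decidable AtOrJustBelow
atOrJustBelow? a b = (b ℕ.≟ a) ⊎-dec (suc b ℕ.≟ a)

module Layering {n} {G : Graph n} (L : Layered G) where

  open Layered L

  extend : (Fin n → ℕ) → Fin n → Fin n → ℕ
  extend ℓ v w = if does (w ≺? v) then suc (ℓ w) else 0

  layerWithin : ℕ → Fin n → ℕ
  layerWithin zero v = 0
  layerWithin (suc fuel) v = max (extend (layerWithin fuel) v)

  layerWithin-stable : ∀ fuel v → potential v < fuel → layerWithin fuel v ≡ layerWithin (suc fuel) v
  layerWithin-stable (suc fuel) v v<fuel = max-cong λ w → extend-stable w (w ≺? v)
    where
    extend-stable : ∀ w (w≺?v : Dec (w ≺ v)) → (if does w≺?v then suc (layerWithin fuel w) else 0) ≡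
                                              (if does w≺?v then suc (layerWithin (suc fuel) w) else 0)
    extend-stable w (yes w≺v) =
      cong suc (layerWithin-stable fuel w (ℕ.<-≤-trans (≺⇒potential< w≺v) (ℕ.≤-pred v<fuel)))
    extend-stable w (no _) = refl

  layer : Fin n → ℕ
  layer = layerWithin (suc (max potential))

  layer-unfold : ∀ v → layer v ≡ max (extend layer v)
  layer-unfold v = layerWithin-stable _ v (s≤s (≤-max potential v))

  ≺⇒layer< : ∀ {u v} → u ≺ v → layer u < layer v
  ≺⇒layer< {u} {v} u≺v = subst (suc (layer u) ≤_) (sym (layer-unfold v))
    (subst (_≤ max (extend layer v)) (cong (λ b → if b then suc (layer u) else 0) (dec-true (u ≺? v) u≺v))
           (≤-max (extend layer v) u))

  layer-pred : ∀ v d → layer v ≡ suc d → ∃ λ w → w ≺ v × layer w ≡ d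
  layer-pred v d v≡ with max-attained (extend layer v)
  ... | inj₁ ≡0 = ⊥-elim (ℕ.1+n≢0 (trans (sym v≡) (trans (layer-unfold v) ≡0)))
  ... | inj₂ (w , ≡w) with w ≺? v
  ...   | yes w≺v = w , w≺v , ℕ.suc-injective (trans (sym ≡w) (trans (sym (layer-unfold v)) v≡))
  ...   | no _ = ⊥-elim (ℕ.1+n≢0 (trans (sym v≡) (trans (layer-unfold v) ≡w)))

  -- If z ≺ w ≺ u ends a longest chain below u, then z ≺ v for every neighbour v of u.
  adj⇒layer≤ : ∀ {u v} → adj G u v ≡ true → layer u ≤ suc (layer v)
  adj⇒layer≤ {u} {v} uv with layer u in u≡
  ... | zero = z≤n
  ... | suc zero = s≤s z≤n
  ... | suc (suc d) with layer-pred u (suc d) u≡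
  ...   | w , w≺u , w≡ with layer-pred w d w≡
  ...     | z , z≺w , z≡ = s≤s (subst (_< layer v) z≡ (≺⇒layer< (≺-≺-adj⇒≺ z≺w w≺u uv)))

  rightmostPredecessor : ∀ v → (Σ (Fin n) λ w → (w ≺ v × suc (layer w) ≡ layer v) ×
                                    ∀ w′ → w′ ≺ v × suc (layer w′) ≡ layer v → pos w′ ≤ℚ pos w) ⊎
                                 (∀ w → ¬ (w ≺ v × suc (layer w) ≡ layer v))
  rightmostPredecessor v = argmax pos (λ w → (w ≺? v) ×-dec (suc (layer w) ℕ.≟ layer v))

  -- key d v lists pos along v₀ ≺ v₁ ≺ … ≺ v_d = v, each vᵢ the rightmost ≺-predecessor of vᵢ₊₁
  -- in the layer below.
  key : ℕ → Fin n → List ℚ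
  key zero v = [ pos v ]
  key (suc d) v with rightmostPredecessor v
  ... | inj₁ (w , _) = key d w ∷ʳ pos v
  ... | inj₂ _ = [ pos v ]

  key-suc : ∀ d v → layer v ≡ suc d →
    Σ (Fin n) λ w → (w ≺ v × layer w ≡ d) × (∀ w′ → w′ ≺ v → layer w′ ≡ d → pos w′ ≤ℚ pos w) ×
                    key (suc d) v ≡ key d w ∷ʳ pos v
  key-suc d v v≡ with rightmostPredecessor v
  ... | inj₁ (w , (w≺v , w≡) , w-max) =
    w , (w≺v , ℕ.suc-injective (trans w≡ v≡)) ,
    (λ w′ w′≺v w′≡ → w-max w′ (w′≺v , trans (cong suc w′≡) (sym v≡))) , refl
  ... | inj₂ none with layer-pred v d v≡
  ...   | w , w≺v , w≡ = ⊥-elim (none w (w≺v , trans (cong suc w≡) (sym v≡)))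

  length-key : ∀ d x → layer x ≡ d → length (key d x) ≡ suc d
  length-key zero x _ = refl
  length-key (suc d) x x≡ with key-suc d x x≡
  ... | w , (_ , w≡) , _ , key≡ = trans (cong length key≡)
          (trans (length-++ (key d w)) (trans (cong (_+ 1) (length-key d w w≡)) (cong suc (ℕ.+-comm d 1))))

  same-length : ∀ {d x y} → layer x ≡ d → layer y ≡ d → length (key d x) ≡ length (key d y)
  same-length {d} {x} {y} x≡ y≡ = trans (length-key d x x≡) (sym (length-key d y y≡))

  ≺-same-side : ∀ {w x w′ x′} → w ≺ x → w′ ≺ x′ → side x ≡ side x′ → side w ≡ side w′
  ≺-same-side {w′ = w′} w≺x w′≺x′ x≡x′ =
    sym (compatible⇒≺-side w≺x (subst (λ s → compatible (side w′) s ≡ true) (sym x≡x′) (≺⇒compatible w′≺x′)))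

  key-mono : ∀ d {x x′} → layer x ≡ d → layer x′ ≡ d → side x ≡ side x′ →
             pos x ≤ℚ pos x′ → key d x ≤ₗ key d x′
  key-mono zero _ _ _ x≤x′ = ∷ʳ-mono-≤ₗ {[]} {[]} refl (base _) x≤x′
  key-mono (suc d) {x} {x′} x≡ x′≡ sides x≤x′ with key-suc d x x≡ | key-suc d x′ x′≡
  ... | w , (w≺x , w≡) , _ , key≡ | w′ , (w′≺x′ , w′≡) , w′-max , key′≡ =
    subst₂ _≤ₗ_ (sym key≡) (sym key′≡)
      (∷ʳ-mono-≤ₗ (same-length w≡ w′≡)
        (key-mono d w≡ w′≡ (≺-same-side w≺x w′≺x′ sides) (w′-max w (≺-closedʳ w≺x sides x≤x′) w≡)) x≤x′)

  key-mono-< : ∀ d {x x′} → layer x ≡ d → layer x′ ≡ d → side x ≡ side x′ →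
               pos x <ℚ pos x′ → key d x <ₗ key d x′
  key-mono-< zero _ _ _ x<x′ = ∷ʳ-mono-<ₗ {[]} {[]} refl (base _) x<x′
  key-mono-< (suc d) {x} {x′} x≡ x′≡ sides x<x′ with key-suc d x x≡ | key-suc d x′ x′≡
  ... | w , (w≺x , w≡) , _ , key≡ | w′ , (w′≺x′ , w′≡) , w′-max , key′≡ =
    subst₂ _<ₗ_ (sym key≡) (sym key′≡)
      (∷ʳ-mono-<ₗ (same-length w≡ w′≡)
        (key-mono d w≡ w′≡ (≺-same-side w≺x w′≺x′ sides)
                  (w′-max w (≺-closedʳ w≺x sides (ℚ.<⇒≤ x<x′)) w≡)) x<x′)

  fullKey : Fin n → List ℚ
  fullKey v = key (layer v) v

  module _ {x v} (x≡v-1 : suc (layer x) ≡ layer v) (x~v : compatible (side x) (side v) ≡ true) where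

    ≺⇒fullKey< : x ≺ v → fullKey x <ₗ fullKey v
    ≺⇒fullKey< x≺v with key-suc (layer x) v (sym x≡v-1)
    ... | w , (w≺v , w≡) , w-max , key≡ =
      subst (λ d → fullKey x <ₗ key d v) x≡v-1 (subst (fullKey x <ₗ_) (sym key≡)
        (≤ₗ⇒<ₗ∷ʳ (same-length refl w≡)
          (key-mono (layer x) refl w≡ (compatible⇒≺-side w≺v x~v) (w-max x x≺v refl)) (pos v)))

    ¬≺⇒fullKey> : ¬ x ≺ v → fullKey v <ₗ fullKey x
    ¬≺⇒fullKey> x⊀v with key-suc (layer x) v (sym x≡v-1)
    ... | w , (w≺v , w≡) , _ , key≡ =
      subst (λ d → key d v <ₗ fullKey x) x≡v-1 (subst (_<ₗ fullKey x) (sym key≡)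
        (<ₗ⇒∷ʳ<ₗ (same-length w≡ refl)
          (key-mono-< (layer x) w≡ refl (sym x~w) (ℚ.≰⇒> λ x≤w → x⊀v (≺-closedˡ w≺v x~w x≤w))) (pos v)))
      where
      x~w : side x ≡ side w
      x~w = compatible⇒≺-side w≺v x~v

  adj≡compatible : ∀ {u v} → u ≢ v → ¬ (u ≺ v ⊎ v ≺ u) → adj G u v ≡ compatible (side u) (side v)
  adj≡compatible {u} {v} u≢v incomparable with adj G u v in uv | compatible (side u) (side v) in u~v
  ... | true | true = refl
  ... | true | false = ⊥-elim (false≢true (trans (sym u~v) (adj⇒compatible uv)))
  ... | false | false = refl
  ... | false | true = ⊥-elim (incomparable (¬adj⇒≺ u≢v u~v uv))

  adj-byKey : ∀ {u v} → u ≢ v → fullKey u ≤ₗ fullKey v →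
              adj G u v ≡ compatible (side u) (side v) ∧ does (atOrJustBelow? (layer u) (layer v))
  adj-byKey {u} {v} u≢v u≤v with ℕ.<-cmp (layer u) (layer v)
  ... | tri≈ _ u≡v _ = trans (adj≡compatible u≢v Sum.[ (λ u≺v → ℕ.<-irrefl u≡v (≺⇒layer< u≺v))
                                                    , (λ v≺u → ℕ.<-irrefl (sym u≡v) (≺⇒layer< v≺u)) ])
                             (sym (∧-does-yes _ (atOrJustBelow? _ _) (inj₁ (sym u≡v))))
  ... | tri< u<v _ _ = trans (¬-not nonadjacent) (sym (∧-does-no _ (atOrJustBelow? _ _) apart))
    where
    apart : ¬ AtOrJustBelow (layer u) (layer v)
    apart (inj₁ v≡u) = ℕ.<-irrefl (sym v≡u) u<v
    apart (inj₂ v+1≡u) = ℕ.<-asym u<v (subst (layer v <_) v+1≡u ℕ.≤-refl)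
    nonadjacent : adj G u v ≢ true
    nonadjacent uv = <ₗ⇒≱ₗ (¬≺⇒fullKey> u+1≡v (adj⇒compatible uv) (adj⇒¬≺ uv)) u≤v
      where
      u+1≡v : suc (layer u) ≡ layer v
      u+1≡v = ℕ.≤-antisym u<v (adj⇒layer≤ (trans (adj-sym G v u) uv))
  ... | tri> _ _ v<u with suc (layer v) ℕ.≟ layer u
  ...   | yes v+1≡u = trans (adj≡compatible u≢v incomparable) (sym (∧-does-yes _ (atOrJustBelow? _ _) (inj₂ v+1≡u)))
    where
    incomparable : ¬ (u ≺ v ⊎ v ≺ u)
    incomparable (inj₁ u≺v) = ℕ.<-asym v<u (≺⇒layer< u≺v)
    incomparable (inj₂ v≺u) = <ₗ⇒≱ₗ (≺⇒fullKey< v+1≡u (≺⇒compatible v≺u) v≺u) u≤v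
  ...   | no v+1≢u = trans (¬-not nonadjacent) (sym (∧-does-no _ (atOrJustBelow? _ _) apart))
    where
    apart : ¬ AtOrJustBelow (layer u) (layer v)
    apart (inj₁ v≡u) = ℕ.<-irrefl v≡u v<u
    apart (inj₂ v+1≡u) = v+1≢u v+1≡u
    nonadjacent : adj G u v ≢ true
    nonadjacent uv = v+1≢u (ℕ.≤-antisym v<u (adj⇒layer≤ uv))

-- Colouring by layers

module _ {d : ℕ} .{{_ : NonZero d}} where

  %-unshift : ∀ x {c r} → c + r ≡ d → r < d → (x + c) % d ≡ 0 → x % d ≡ r
  %-unshift x {c} {r} c+r≡d r<d x+c≡0 = begin
    x % d                         ≡⟨ sym ([m+n]%n≡m%n x d) ⟩
    (x + d) % d                   ≡⟨ cong (λ y → (x + y) % d) (sym c+r≡d) ⟩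
    (x + (c + r)) % d             ≡⟨ cong (_% d) (sym (ℕ.+-assoc x c r)) ⟩
    (x + c + r) % d               ≡⟨ %-distribˡ-+ (x + c) r d ⟩
    ((x + c) % d + r % d) % d     ≡⟨ cong (λ y → (y + r % d) % d) x+c≡0 ⟩
    r % d % d                     ≡⟨ m%n%n≡m%n r d ⟩
    r % d                         ≡⟨ m<n⇒m%n≡m r<d ⟩
    r                             ∎
    where open ≡-Reasoning

  %-absorbˡ : ∀ x c → (x + c) % d ≡ (x % d + c) % d
  %-absorbˡ x c = begin
    (x + c) % d                   ≡⟨ %-distribˡ-+ x c d ⟩
    (x % d + c % d) % d           ≡⟨ cong (λ y → (y + c % d) % d) (sym (m%n%n≡m%n x d)) ⟩
    (x % d % d + c % d) % d       ≡⟨ sym (%-distribˡ-+ (x % d) c d) ⟩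
    (x % d + c) % d               ∎
    where open ≡-Reasoning

  /≡⇒[k+]⇔%[k+] : ∀ {a b} k → a / d ≡ b / d → (k + b ≡ a ⇔ k + b % d ≡ a % d)
  /≡⇒[k+]⇔%[k+] {a} {b} k a/≡b/ = mk⇔
    (λ k+b≡a → ℕ.+-cancelʳ-≡ (q * d) _ _ (begin
      k + b % d + q * d           ≡⟨ ℕ.+-assoc k (b % d) (q * d) ⟩
      k + (b % d + q * d)         ≡⟨ cong (k +_) (sym b≡) ⟩
      k + b                       ≡⟨ k+b≡a ⟩
      a                           ≡⟨ a≡ ⟩
      a % d + q * d               ∎))
    (λ k+b%≡a% → begin
      k + b                       ≡⟨ cong (k +_) b≡ ⟩
      k + (b % d + q * d)         ≡⟨ sym (ℕ.+-assoc k (b % d) (q * d)) ⟩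
      k + b % d + q * d           ≡⟨ cong (_+ q * d) k+b%≡a% ⟩
      a % d + q * d               ≡⟨ sym a≡ ⟩
      a                           ∎)
    where
    open ≡-Reasoning
    q : ℕ
    q = a / d
    a≡ : a ≡ a % d + q * d
    a≡ = m≡m%n+[m/n]*n a d
    b≡ : b ≡ b % d + q * d
    b≡ = trans (m≡m%n+[m/n]*n b d) (cong (λ y → b % d + y * d) (sym a/≡b/))

  1+m%≢0⇒1+m/≡m/ : ∀ a → suc a % d ≢ 0 → suc a / d ≡ a / d
  1+m%≢0⇒1+m/≡m/ a 1+a%≢0 with suc (a % d) ℕ.≟ d
  ... | yes 1+a%≡d = ⊥-elim (1+a%≢0 (begin
    suc a % d                     ≡⟨ cong (λ y → suc y % d) (m≡m%n+[m/n]*n a d) ⟩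
    (suc (a % d) + a / d * d) % d ≡⟨ cong (λ y → (y + a / d * d) % d) 1+a%≡d ⟩
    (d + a / d * d) % d           ≡⟨ [m+kn]%n≡m%n d (a / d) d ⟩
    d % d                         ≡⟨ n%n≡0 d ⟩
    0                             ∎))
    where open ≡-Reasoning
  ... | no 1+a%≢d = begin
    suc a / d                     ≡⟨ cong (_/ d) (ℕ.+-comm 1 a) ⟩
    (a + 1) / d                   ≡⟨ +-distrib-/ a 1 a%+1%<d ⟩
    a / d + 1 / d                 ≡⟨ cong (a / d +_) (m<n⇒m/n≡0 1<d) ⟩
    a / d + 0                     ≡⟨ ℕ.+-identityʳ _ ⟩
    a / d                         ∎
    where
    open ≡-Reasoning
    1+a%<d : suc (a % d) < d
    1+a%<d = ℕ.≤∧≢⇒< (m%n<n a d) 1+a%≢d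
    1<d : 1 < d
    1<d = ℕ.≤-<-trans (s≤s z≤n) 1+a%<d
    a%+1%<d : a % d + 1 % d < d
    a%+1%<d = subst (_< d) (trans (ℕ.+-comm 1 (a % d)) (cong (a % d +_) (sym (m<n⇒m%n≡m 1<d)))) 1+a%<d

missedColour : ∀ {i d} → i < d → (C : Fin i → Fin d) → ∃ λ r → ∀ j → C j ≢ r
missedColour {i} {d} i<d C with Fin.all? (λ r → Fin.any? (λ j → C j ≟ r))
... | no ¬allHit =
  Prod.map₂ (λ ¬hit j Cj≡r → ¬hit (j , Cj≡r)) (Fin.¬∀⟶∃¬ d _ (λ r → Fin.any? (λ j → C j ≟ r)) ¬allHit)
... | yes allHit = ⊥-elim (ℕ.<⇒≱ i<d (Fin.injective⇒≤ {f = proj₁ ∘ allHit}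
                       λ {r} {r′} e → trans (sym (proj₂ (allHit r))) (trans (cong C e) (proj₂ (allHit r′)))))

Key : Set
Key = ℕ × List ℚ

keyOrder : DecTotalOrder 0ℓ 0ℓ 0ℓ
keyOrder = ×-decTotalOrder ℕ.≤-decTotalOrder (lex-decTotalOrder ℚ.<-strictTotalOrder)

module Colouring {n} {G : Graph n} (L : Layered G) (p : ℕ) where

  open Layered L
  open Layering L

  colour : Fin n → Fin (suc p)
  colour v = fromℕ< (m%n<n (layer v) (suc p))

  -- With i ≤ p colours chosen, the missed colour r cuts the layers into blocks of p + 1 consecutive
  -- layers starting at a layer of colour r; no edge joins chosen vertices of different blocks.
  module ChosenColours {i} (i≤p : i ≤ p) (C : Fin i → Fin (suc p)) where

    Chosen : Fin n → Set
    Chosen v = ∃ λ j → colour v ≡ C j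

    chosen? : ∀ v → Dec (Chosen v)
    chosen? v = Fin.any? (λ j → colour v ≟ C j)

    r : Fin (suc p)
    r = proj₁ (missedColour (s≤s i≤p) C)

    shift : ℕ
    shift = suc p ∸ toℕ r

    block offset : Fin n → ℕ
    block v = (layer v + shift) / suc p
    offset v = (layer v + shift) % suc p

    offset≢0 : ∀ {v} → Chosen v → offset v ≢ 0
    offset≢0 {v} (j , colour≡) offset≡0 = proj₂ (missedColour (s≤s i≤p) C) j (trans (sym colour≡)
      (Fin.toℕ-injective (trans (Fin.toℕ-fromℕ< _)
        (%-unshift (layer v) (ℕ.m∸n+n≡m (ℕ.<⇒≤ (Fin.toℕ<n r))) (Fin.toℕ<n r) offset≡0))))

    layer+1⇒sameBlock : ∀ {u v} → Chosen v → suc (layer u) ≡ layer v → block v ≡ block u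
    layer+1⇒sameBlock {u} {v} chosen u+1≡v =
      trans (cong (λ l → (l + shift) / suc p) (sym u+1≡v))
            (1+m%≢0⇒1+m/≡m/ (layer u + shift) (offset≢0 chosen ∘ trans (cong (λ l → (l + shift) % suc p) (sym u+1≡v))))

    adj⇒sameBlock : ∀ {u v} → Chosen u → Chosen v → adj G u v ≡ true → block u ≡ block v
    adj⇒sameBlock {u} {v} cu cv uv with ℕ.<-cmp (layer u) (layer v)
    ... | tri≈ _ u≡v _ = cong (λ l → (l + shift) / suc p) u≡v
    ... | tri< u<v _ _ = sym (layer+1⇒sameBlock cv (ℕ.≤-antisym u<v (adj⇒layer≤ (trans (adj-sym G v u) uv))))
    ... | tri> _ _ v<u = layer+1⇒sameBlock cu (ℕ.≤-antisym v<u (adj⇒layer≤ uv))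

    sameBlock⇒[k+]⇔ : ∀ {u v} → block u ≡ block v → ∀ k → (k + layer v ≡ layer u ⇔ k + offset v ≡ offset u)
    sameBlock⇒[k+]⇔ {u} {v} u≡v k = mk⇔
      (to (/≡⇒[k+]⇔%[k+] k u≡v) ∘ λ e → trans (sym (ℕ.+-assoc k (layer v) shift)) (cong (_+ shift) e))
      (λ e → ℕ.+-cancelʳ-≡ shift _ _ (trans (ℕ.+-assoc k (layer v) shift) (from (/≡⇒[k+]⇔%[k+] k u≡v) e)))

    colourIndex : Fin n → Fin (suc i)
    colourIndex v with chosen? v
    ... | yes (j , _) = suc j
    ... | no _ = zero

    offsetAt : Fin (suc i) → ℕ
    offsetAt zero = 0
    offsetAt (suc j) = (toℕ (C j) + shift) % suc p

    offsetAt-colourIndex : ∀ {v} → Chosen v → offsetAt (colourIndex v) ≡ offset v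
    offsetAt-colourIndex {v} chosen with chosen? v
    ... | no ¬chosen = ⊥-elim (¬chosen chosen)
    ... | yes (j , colour≡) = begin
      (toℕ (C j) + shift) % suc p           ≡⟨ cong (λ c → (toℕ c + shift) % suc p) (sym colour≡) ⟩
      (toℕ (colour v) + shift) % suc p      ≡⟨ cong (λ y → (y + shift) % suc p) (Fin.toℕ-fromℕ< (m%n<n (layer v) (suc p))) ⟩
      (layer v % suc p + shift) % suc p     ≡⟨ sym (%-absorbˡ (layer v) shift) ⟩
      offset v                              ∎
      where open ≡-Reasoning

    encode : Bool → Fin (suc i) → Fin (suc i + suc i)
    encode false j = join (suc i) (suc i) (inj₁ j)
    encode true j = join (suc i) (suc i) (inj₂ j)

    decode : Fin (suc i + suc i) → Bool × Fin (suc i)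
    decode t = Sum.[ (false ,_) , (true ,_) ] (splitAt (suc i) t)

    decode-encode : ∀ s j → decode (encode s j) ≡ (s , j)
    decode-encode false j rewrite Fin.splitAt-join (suc i) (suc i) (inj₁ j) = refl
    decode-encode true j rewrite Fin.splitAt-join (suc i) (suc i) (inj₂ j) = refl

    type : Fin n → Fin (suc i + suc i)
    type v = encode (side v) (colourIndex v)

    adjacentTypes : Bool × Fin (suc i) → Bool × Fin (suc i) → Bool
    adjacentTypes (s , j) (s′ , j′) = compatible s s′ ∧ does (atOrJustBelow? (offsetAt j) (offsetAt j′))

    Φ : Fin (suc i + suc i) → Fin (suc i + suc i) → Bool
    Φ t t′ = adjacentTypes (decode t) (decode t′)

    Φ-type : ∀ {u v} → Chosen u → Chosen v →
             Φ (type u) (type v) ≡ compatible (side u) (side v) ∧ does (atOrJustBelow? (offset u) (offset v))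
    Φ-type {u} {v} cu cv rewrite decode-encode (side u) (colourIndex u) | decode-encode (side v) (colourIndex v)
                               | offsetAt-colourIndex cu | offsetAt-colourIndex cv = refl

    sortKey : Fin n → Key
    sortKey v = block v , fullKey v

    open DecTotalOrder keyOrder using () renaming (_≤_ to _≼_)

    block-mono : ∀ u v → sortKey u ≼ sortKey v → block u ≤ block v
    block-mono u v (inj₁ (u≤v , _)) = u≤v
    block-mono u v (inj₂ (u≡v , _)) = ℕ.≤-reflexive u≡v

    adj-typed : ∀ u v → Chosen u → Chosen v → u ≢ v → sortKey u ≼ sortKey v →
                adj G u v ≡ does (block u ℕ.≟ block v) ∧ Φ (type u) (type v)
    adj-typed u v cu cv _ (inj₁ (_ , u≢v)) =
      trans (¬-not (u≢v ∘ adj⇒sameBlock cu cv)) (sym (cong (_∧ Φ (type u) (type v)) (dec-false (block u ℕ.≟ block v) u≢v)))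
    adj-typed u v cu cv u≢v (inj₂ (u≡v , u≤v)) = begin
      adj G u v
        ≡⟨ adj-byKey u≢v u≤v ⟩
      compatible (side u) (side v) ∧ does (atOrJustBelow? (layer u) (layer v))
        ≡⟨ cong (compatible (side u) (side v) ∧_) layers≡offsets ⟩
      compatible (side u) (side v) ∧ does (atOrJustBelow? (offset u) (offset v))
        ≡⟨ sym (Φ-type cu cv) ⟩
      Φ (type u) (type v)
        ≡⟨ cong (_∧ Φ (type u) (type v)) (sym (dec-true (block u ℕ.≟ block v) u≡v)) ⟩
      does (block u ℕ.≟ block v) ∧ Φ (type u) (type v)
        ∎
      where
      open ≡-Reasoning
      layers⇔offsets : AtOrJustBelow (layer u) (layer v) ⇔ AtOrJustBelow (offset u) (offset v)
      layers⇔offsets = mk⇔ (Sum.map (to (sameBlock⇒[k+]⇔ u≡v 0)) (to (sameBlock⇒[k+]⇔ u≡v 1)))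
                           (Sum.map (from (sameBlock⇒[k+]⇔ u≡v 0)) (from (sameBlock⇒[k+]⇔ u≡v 1)))
      layers≡offsets : does (atOrJustBelow? (layer u) (layer v)) ≡ does (atOrJustBelow? (offset u) (offset v))
      layers≡offsets = does-⇔ layers⇔offsets (atOrJustBelow? _ _) (atOrJustBelow? _ _)

    rankWidth : InducedRankWidth≤ G Chosen (suc i + suc i)
    rankWidth = keyTyped⇒InducedRankWidth≤ G chosen? keyOrder sortKey block type Φ block-mono adj-typed

layered⇒lowRankWidthColourings : (D : GraphClass) → (∀ n G → D n G → Layered G) → AdmitsLowRankWidthColorings D
layered⇒lowRankWidthColourings D layered =
  suc , (λ i → suc i + suc i) , λ p n G inD →
    Colouring.colour (layered n G inD) p , λ i i≤p C _ → Colouring.ChosenColours.rankWidth (layered n G inD) p i≤p C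

-- Unit interval graphs

x≤x+ℓ : ∀ x {ℓ} → 0ℚ ≤ℚ ℓ → x ≤ℚ x +ℚ ℓ
x≤x+ℓ x {ℓ} 0≤ℓ = subst (_≤ℚ x +ℚ ℓ) (ℚ.+-identityʳ x) (ℚ.+-monoʳ-≤ x 0≤ℓ)

unitInterval⇒layered : ∀ n (G : Graph n) → UnitInterval n G → Layered G
unitInterval⇒layered n G (ℓ , a , 0≤ℓ , adj⇔meet) = record
  { side              = λ _ → false
  ; compatible        = λ _ _ → true
  ; pos               = a
  ; _≺_               = λ u v → a u +ℚ ℓ <ℚ a v
  ; _≺?_              = λ u v → (a u +ℚ ℓ) ℚ.<? a v
  ; potential         = height (λ u v → a u ℚ.<? a v)
  ; ≺⇒potential<      = ⊏⇒height< (λ u v → a u ℚ.<? a v) ℚ.<-trans (ℚ.<-irrefl refl) ∘ ≺⇒<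
  ; adj⇒compatible    = λ _ → refl
  ; ≺⇒compatible      = λ _ → refl
  ; adj⇒¬≺            = λ uv u≺v → ℚ.<-irrefl refl (ℚ.<-≤-trans u≺v (adj⇒near uv))
  ; ¬adj⇒≺            = λ u≢v _ ¬uv → apart u≢v ¬uv
  ; ≺-≺-adj⇒≺         = ≺-≺-adj⇒≺
  ; ≺-closedˡ         = λ w≺v _ x≤w → ℚ.≤-<-trans (ℚ.+-monoˡ-≤ ℓ x≤w) w≺v
  ; ≺-closedʳ         = λ w≺v _ v≤v′ → ℚ.<-≤-trans w≺v v≤v′
  ; compatible⇒≺-side = λ _ _ → refl
  }
  where
  ≺⇒< : ∀ {u v} → a u +ℚ ℓ <ℚ a v → a u <ℚ a v
  ≺⇒< {u} = ℚ.≤-<-trans (x≤x+ℓ (a u) 0≤ℓ)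
  adj⇒near : ∀ {u v} → adj G u v ≡ true → a v ≤ℚ a u +ℚ ℓ
  adj⇒near {u} {v} uv with to (adj⇔meet u v (adj⇒≢ G uv)) uv
  ... | q , (_ , q≤a+ℓ) , (a≤q , _) = ℚ.≤-trans a≤q q≤a+ℓ
  cancelℓ : ∀ {p q} → p +ℚ ℓ <ℚ q +ℚ ℓ → p <ℚ q
  cancelℓ {p} {q} p+ℓ<q+ℓ = ℚ.≰⇒> λ q≤p → ℚ.<-irrefl refl (ℚ.<-≤-trans p+ℓ<q+ℓ (ℚ.+-monoˡ-≤ ℓ q≤p))
  ≺-≺-adj⇒≺ : ∀ {z w u v} → a z +ℚ ℓ <ℚ a w → a w +ℚ ℓ <ℚ a u → adj G u v ≡ true → a z +ℚ ℓ <ℚ a v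
  ≺-≺-adj⇒≺ {u = u} {v} z≺w w≺u uv =
    cancelℓ (ℚ.<-≤-trans (ℚ.<-trans (ℚ.+-monoˡ-< ℓ z≺w) w≺u) (adj⇒near (trans (adj-sym G v u) uv)))
  apart : ∀ {u v} → u ≢ v → adj G u v ≡ false → a u +ℚ ℓ <ℚ a v ⊎ a v +ℚ ℓ <ℚ a u
  apart {u} {v} u≢v ¬uv with (a u +ℚ ℓ) ℚ.<? a v | (a v +ℚ ℓ) ℚ.<? a u
  ... | yes u≺v | _ = inj₁ u≺v
  ... | no _ | yes v≺u = inj₂ v≺u
  ... | no u⊀v | no v⊀u = ⊥-elim (false≢true (trans (sym ¬uv) (from (adj⇔meet u v u≢v) common)))
    where
    common : ∃ λ q → (a u ≤ℚ q × q ≤ℚ a u +ℚ ℓ) × (a v ≤ℚ q × q ≤ℚ a v +ℚ ℓ)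
    common with a u ℚ.≤? a v
    ... | yes u≤v = a v , (u≤v , ℚ.≮⇒≥ u⊀v) , (ℚ.≤-refl , x≤x+ℓ (a v) 0≤ℓ)
    ... | no u≰v = a u , (ℚ.≤-refl , x≤x+ℓ (a u) 0≤ℓ) , (ℚ.<⇒≤ (ℚ.≰⇒> u≰v) , ℚ.≮⇒≥ v⊀u)

-- Bipartite permutation graphs

at : ℚ → ℚ → ℚ → ℚ
at x y s = x +ℚ s *ℚ (y -ℚ x)

0<1 : 0ℚ <ℚ 1ℚ
0<1 = ℚ.positive⁻¹ 1ℚ

0<b-a : ∀ {a b} → a <ℚ b → 0ℚ <ℚ b -ℚ a
0<b-a {a} {b} a<b = subst (_<ℚ b -ℚ a) (ℚ.+-inverseʳ a) (ℚ.+-monoˡ-< (- a) a<b)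

0≤b-a : ∀ {a b} → a ≤ℚ b → 0ℚ ≤ℚ b -ℚ a
0≤b-a {a} {b} a≤b = subst (_≤ℚ b -ℚ a) (ℚ.+-inverseʳ a) (ℚ.+-monoˡ-≤ (- a) a≤b)

at-convex : ∀ x y s → at x y s ≡ (1ℚ -ℚ s) *ℚ x +ℚ s *ℚ y
at-convex = solve 3 (λ x y s → x :+ s :* (y :- x) := (con 1ℚ :- s) :* x :+ s :* y) refl
  where open +-*-Solver

at-strictMono : ∀ {x x′ y y′ s} → x <ℚ x′ → y <ℚ y′ → 0ℚ ≤ℚ s → s ≤ℚ 1ℚ → at x y s <ℚ at x′ y′ s
at-strictMono {x} {x′} {y} {y′} {s} x<x′ y<y′ 0≤s s≤1 =
  subst₂ _<ℚ_ (sym (at-convex x y s)) (sym (at-convex x′ y′ s)) (combine (s ℚ.<? 1ℚ))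
  where
  combine : Dec (s <ℚ 1ℚ) → (1ℚ -ℚ s) *ℚ x +ℚ s *ℚ y <ℚ (1ℚ -ℚ s) *ℚ x′ +ℚ s *ℚ y′
  combine (yes s<1) = ℚ.+-mono-<-≤ (ℚ.*-monoʳ-<-pos (1ℚ -ℚ s) {{ℚ.positive (0<b-a s<1)}} x<x′)
                                  (ℚ.*-monoˡ-≤-nonNeg s {{ℚ.nonNegative 0≤s}} (ℚ.<⇒≤ y<y′))
  combine (no s≮1) = ℚ.+-mono-≤-< (ℚ.*-monoˡ-≤-nonNeg (1ℚ -ℚ s) {{ℚ.nonNegative (0≤b-a s≤1)}} (ℚ.<⇒≤ x<x′))
                                  (ℚ.*-monoʳ-<-pos s {{ℚ.positive (subst (0ℚ <ℚ_) (sym s≡1) 0<1)}} y<y′)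
    where
    s≡1 : s ≡ 1ℚ
    s≡1 = ℚ.≤-antisym s≤1 (ℚ.≮⇒≥ s≮1)

Meet : ℚ → ℚ → ℚ → ℚ → Set
Meet x x′ y y′ = ∃ λ s → (0ℚ ≤ℚ s × s ≤ℚ 1ℚ) × at x y s ≡ at x′ y′ s

-- The segments cross at s = (x − x′) / ((x − x′) + (y′ − y)).
crossing : ∀ {x x′ y y′} → x′ <ℚ x → y <ℚ y′ → Meet x x′ y y′
crossing {x} {x′} {y} {y′} x′<x y<y′ = s , (0≤s , s≤1) , meet
  where
  a b : ℚ
  a = x -ℚ x′
  b = y′ -ℚ y
  0<a : 0ℚ <ℚ a
  0<a = 0<b-a x′<x
  0<a+b : 0ℚ <ℚ a +ℚ b
  0<a+b = subst (_<ℚ a +ℚ b) (ℚ.+-identityˡ 0ℚ) (ℚ.+-mono-< 0<a (0<b-a y<y′))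
  instance
    a+b≢0 : ℚ.NonZero (a +ℚ b)
    a+b≢0 = ℚ.>-nonZero 0<a+b
    a+b>0 : ℚ.Positive (a +ℚ b)
    a+b>0 = ℚ.positive 0<a+b
    1/[a+b]>0 : ℚ.Positive (1/ (a +ℚ b))
    1/[a+b]>0 = ℚ.1/pos⇒pos (a +ℚ b)
  s : ℚ
  s = a *ℚ 1/ (a +ℚ b)
  0≤s : 0ℚ ≤ℚ s
  0≤s = ℚ.<⇒≤ (subst (_<ℚ s) (ℚ.*-zeroˡ (1/ (a +ℚ b))) (ℚ.*-monoˡ-<-pos (1/ (a +ℚ b)) 0<a))
  s≤1 : s ≤ℚ 1ℚ
  s≤1 = subst (s ≤ℚ_) (ℚ.*-inverseʳ (a +ℚ b))
          (ℚ.*-monoʳ-≤-nonNeg (1/ (a +ℚ b)) {{ℚ.pos⇒nonNeg (1/ (a +ℚ b))}}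
            (subst (_≤ℚ a +ℚ b) (ℚ.+-identityʳ a) (ℚ.+-monoʳ-≤ a (ℚ.<⇒≤ (0<b-a y<y′)))))
  s[a+b]≡a : s *ℚ (a +ℚ b) ≡ a
  s[a+b]≡a = trans (ℚ.*-assoc a _ (a +ℚ b)) (trans (cong (a *ℚ_) (ℚ.*-inverseˡ (a +ℚ b))) (ℚ.*-identityʳ a))
  difference : ∀ x x′ y y′ s → at x y s ≡ at x′ y′ s +ℚ ((x -ℚ x′) -ℚ s *ℚ ((x -ℚ x′) +ℚ (y′ -ℚ y)))
  difference = solve 5 (λ x x′ y y′ s → x :+ s :* (y :- x) :=
                         (x′ :+ s :* (y′ :- x′)) :+ ((x :- x′) :- s :* ((x :- x′) :+ (y′ :- y)))) refl
    where open +-*-Solver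
  meet : at x y s ≡ at x′ y′ s
  meet = begin
    at x y s                    ≡⟨ difference x x′ y y′ s ⟩
    at x′ y′ s +ℚ (a -ℚ s *ℚ (a +ℚ b)) ≡⟨ cong (λ z → at x′ y′ s +ℚ (a -ℚ z)) s[a+b]≡a ⟩
    at x′ y′ s +ℚ (a -ℚ a)        ≡⟨ cong (at x′ y′ s +ℚ_) (ℚ.+-inverseʳ a) ⟩
    at x′ y′ s +ℚ 0ℚ             ≡⟨ ℚ.+-identityʳ _ ⟩
    at x′ y′ s                  ∎
    where open ≡-Reasoning

meet-uncomparable : ∀ {x x′ y y′} → ¬ (x <ℚ x′ × y <ℚ y′) → ¬ (x′ <ℚ x × y′ <ℚ y) → Meet x x′ y y′
meet-uncomparable {x} {x′} {y} {y′} ¬< ¬> with ℚ.<-cmp x x′ | ℚ.<-cmp y y′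
... | tri≈ _ x≡x′ _ | _ = 0ℚ , (ℚ.≤-refl , ℚ.<⇒≤ 0<1) , trans (at-0 x y) (trans x≡x′ (sym (at-0 x′ y′)))
  where
  at-0 : ∀ x y → at x y 0ℚ ≡ x
  at-0 x y = trans (cong (x +ℚ_) (ℚ.*-zeroˡ (y -ℚ x))) (ℚ.+-identityʳ x)
... | _ | tri≈ _ y≡y′ _ = 1ℚ , (ℚ.<⇒≤ 0<1 , ℚ.≤-refl) , trans (at-1 x y) (trans y≡y′ (sym (at-1 x′ y′)))
  where
  at-1 : ∀ x y → at x y 1ℚ ≡ y
  at-1 = solve 2 (λ x y → x :+ con 1ℚ :* (y :- x) := y) refl
    where open +-*-Solver
... | tri< x<x′ _ _ | tri< y<y′ _ _ = ⊥-elim (¬< (x<x′ , y<y′))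
... | tri> _ _ x′<x | tri> _ _ y′<y = ⊥-elim (¬> (x′<x , y′<y))
... | tri> _ _ x′<x | tri< y<y′ _ _ = crossing x′<x y<y′
... | tri< x<x′ _ _ | tri> _ _ y′<y = let (s , s∈ , meet) = crossing x<x′ y′<y in s , s∈ , sym meet

≢⇒xor≡true : ∀ {a b} → a ≢ b → a xor b ≡ true
≢⇒xor≡true {a} {b} a≢b = trans (cong (_xor b) (Bool.¬-not a≢b)) (Bool.xor-inverseˡ b)

xor≡true⇒≢ : ∀ {a b} → a xor b ≡ true → a ≢ b
xor≡true⇒≢ {a} a⊕b refl = false≢true (trans (sym (Bool.xor-same a)) a⊕b)

≢-≢⇒≡ : ∀ {a b c : Bool} → a ≢ b → c ≢ b → a ≡ c
≢-≢⇒≡ a≢b c≢b = trans (Bool.¬-not a≢b) (sym (Bool.¬-not c≢b))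

module BipartitePermutationLayering {n} (G : Graph n) (x y : Fin n → ℚ)
  (adj⇔meet : ∀ i j → i ≢ j → (adj G i j ≡ true ⇔ Meet (x i) (x j) (y i) (y j)))
  (colour : Fin n → Bool) (proper : ∀ i j → adj G i j ≡ true → colour i ≢ colour j) where

  _◁_ : Fin n → Fin n → Set
  u ◁ v = x u <ℚ x v × y u <ℚ y v

  _◁?_ : ∀ u v → Dec (u ◁ v)
  u ◁? v = (x u ℚ.<? x v) ×-dec (y u ℚ.<? y v)

  ◁-trans : ∀ {u v w} → u ◁ v → v ◁ w → u ◁ w
  ◁-trans (x₁ , y₁) (x₂ , y₂) = ℚ.<-trans x₁ x₂ , ℚ.<-trans y₁ y₂

  adj⇒¬◁ : ∀ {u v} → adj G u v ≡ true → ¬ u ◁ v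
  adj⇒¬◁ {u} {v} uv (x< , y<) with to (adj⇔meet u v (adj⇒≢ G uv)) uv
  ... | s , (0≤s , s≤1) , meet = ℚ.<-irrefl meet (at-strictMono x< y< 0≤s s≤1)

  adj⇒¬▷ : ∀ {u v} → adj G u v ≡ true → ¬ v ◁ u
  adj⇒¬▷ {u} {v} uv = adj⇒¬◁ (trans (adj-sym G v u) uv)

  nonadjacent⇒◁ : ∀ {u v} → u ≢ v → adj G u v ≡ false → u ◁ v ⊎ v ◁ u
  nonadjacent⇒◁ {u} {v} u≢v ¬uv with u ◁? v | v ◁? u
  ... | yes u◁v | _ = inj₁ u◁v
  ... | no _ | yes v◁u = inj₂ v◁u
  ... | no u⋪v | no v⋪u = ⊥-elim (false≢true (trans (sym ¬uv) (from (adj⇔meet u v u≢v)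
                            (meet-uncomparable u⋪v v⋪u))))

  sameColour⇒◁ : ∀ {u v} → u ≢ v → colour u ≡ colour v → u ◁ v ⊎ v ◁ u
  sameColour⇒◁ {u} {v} u≢v same = nonadjacent⇒◁ u≢v (Bool.¬-not λ uv → proper u v uv same)

  _≺_ : Fin n → Fin n → Set
  u ≺ v = colour u ≢ colour v × u ◁ v

  ≺-≺-adj⇒≺ : ∀ {z w u v} → z ≺ w → w ≺ u → adj G u v ≡ true → z ≺ v
  ≺-≺-adj⇒≺ {z} {w} {u} {v} (z≢w , z◁w) (w≢u , w◁u) uv =
    (λ z≡v → proper u v uv (trans (sym z≡u) z≡v)) , towards (sameColour⇒◁ w≢v w≡v)
    where
    z≡u : colour z ≡ colour u
    z≡u = ≢-≢⇒≡ z≢w (w≢u ∘ sym)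
    w≡v : colour w ≡ colour v
    w≡v = ≢-≢⇒≡ w≢u (proper u v uv ∘ sym)
    w≢v : w ≢ v
    w≢v refl = adj⇒¬▷ uv w◁u
    towards : w ◁ v ⊎ v ◁ w → z ◁ v
    towards (inj₁ w◁v) = ◁-trans z◁w w◁v
    towards (inj₂ v◁w) = ⊥-elim (adj⇒¬▷ uv (◁-trans v◁w w◁u))

  ≺-closedˡ : ∀ {w v u} → w ≺ v → colour u ≡ colour w → x u ≤ℚ x w → u ≺ v
  ≺-closedˡ {w} {v} {u} (w≢v , w◁v) u≡w u≤w = (w≢v ∘ trans (sym u≡w)) , left (u Fin.≟ w)
    where
    left : Dec (u ≡ w) → u ◁ v
    left (yes refl) = w◁v
    left (no u≢w) with sameColour⇒◁ u≢w u≡w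
    ... | inj₁ u◁w = ◁-trans u◁w w◁v
    ... | inj₂ (w<u , _) = ⊥-elim (ℚ.<-irrefl refl (ℚ.<-≤-trans w<u u≤w))

  ≺-closedʳ : ∀ {w v u} → w ≺ v → colour v ≡ colour u → x v ≤ℚ x u → w ≺ u
  ≺-closedʳ {w} {v} {u} (w≢v , w◁v) v≡u v≤u = (w≢v ∘ flip-trans) , right (v Fin.≟ u)
    where
    flip-trans : colour w ≡ colour u → colour w ≡ colour v
    flip-trans w≡u = trans w≡u (sym v≡u)
    right : Dec (v ≡ u) → w ◁ u
    right (yes refl) = w◁v
    right (no v≢u) with sameColour⇒◁ v≢u v≡u
    ... | inj₁ v◁u = ◁-trans w◁v v◁u
    ... | inj₂ (u<v , _) = ⊥-elim (ℚ.<-irrefl refl (ℚ.<-≤-trans u<v v≤u))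

  layered : Layered G
  layered = record
    { side              = colour
    ; compatible        = _xor_
    ; pos               = x
    ; _≺_               = _≺_
    ; _≺?_              = λ u v → ¬? (colour u Bool.≟ colour v) ×-dec (u ◁? v)
    ; potential         = height _◁?_
    ; ≺⇒potential<      = ⊏⇒height< _◁?_ ◁-trans (λ { (x< , _) → ℚ.<-irrefl refl x< }) ∘ proj₂
    ; adj⇒compatible    = λ uv → ≢⇒xor≡true (proper _ _ uv)
    ; ≺⇒compatible      = ≢⇒xor≡true ∘ proj₁
    ; adj⇒¬≺            = λ uv → adj⇒¬◁ uv ∘ proj₂
    ; ¬adj⇒≺            = λ u≢v u⊕v ¬uv → Sum.map (xor≡true⇒≢ u⊕v ,_) ((xor≡true⇒≢ u⊕v ∘ sym) ,_)
                                                         (nonadjacent⇒◁ u≢v ¬uv)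
    ; ≺-≺-adj⇒≺         = ≺-≺-adj⇒≺
    ; ≺-closedˡ         = ≺-closedˡ
    ; ≺-closedʳ         = ≺-closedʳ
    ; compatible⇒≺-side = λ w≺v u⊕v → ≢-≢⇒≡ (xor≡true⇒≢ u⊕v) (proj₁ w≺v)
    }

bipartitePermutation⇒layered : ∀ n (G : Graph n) → BipartitePermutation n G → Layered G
bipartitePermutation⇒layered n G ((x , y , adj⇔meet) , colour , proper) =
  BipartitePermutationLayering.layered G x y adj⇔meet colour proper

theorem5 : AdmitsLowRankWidthColorings UnitInterval × AdmitsLowRankWidthColorings BipartitePermutation
theorem5 = layered⇒lowRankWidthColourings UnitInterval unitInterval⇒layered ,
           layered⇒lowRankWidthColourings BipartitePermutation bipartitePermutation⇒layered
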